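{- Let $P\in[0,1]^{n\times n}$ be a stochastic matrix with rational entries and consider the Markov chain $(X_0,X_1,\dots)$ on $V=\{1,\dots,n\}$ with transition matrix $P$. Let $W\subset V$ be open and let $\hat P\in\mathbb{R}^{W\times W}$ be the submatrix of $P$ with rows and columns in $W$. Then $I-\hat P$ is invertible and every entry of $(I-\hat P)^{ -1}$ has absolute value at most $\prod_{w\in W}M_w$, and $\prod_{w\in W}M_w \le \min\{D,M^{n-1}\}$.
   Context: A nonempty set $W\subset V$ is open if for every $v\in W$, $\mathbb{P}(\exists \ell,\ X_\ell\notin W\mid X_0=v)>0$. $M_i$ is the lowest common denominator of the entries of row $i$ of $P$, $M$ that of all entries of $P$, and $D\coloneqq M_1\cdots M_n$. (The paper writes the conclusion as $\|(I-\hat P)^{ -1}\|_\infty\le\prod_{w\in W}M_w$, where $\|\cdot\|_\infty$ of a matrix is used as the maximal absolute value of its entries.) -}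

module Defs where

open import Data.Nat as ℕ using (ℕ; zero; suc)
open import Data.Nat.LCM using (lcm)
open import Data.Bool using (Bool; true; false; if_then_else_)
open import Data.Fin using (Fin; _≟_)
open import Relation.Nullary.Decidable using (⌊_⌋)
open import Data.Fin.Subset using (Subset; _∈_; _∉_; Nonempty)
open import Data.Vec using (lookup)
open import Data.Integer using (+_)
open import Data.Vec.Functional using (foldr)
open import Data.Product using (Σ; _×_)
open import Data.Rational as ℚ using (ℚ; 0ℚ; 1ℚ; _+_; _*_; _-_; _≤_; _<_; _/_)
open import Relation.Binary.PropositionalEquality using (_≡_)

Mat : ℕ → Set
Mat n = Fin n → Fin n → ℚ

Σℚ : ∀ {n} → (Fin n → ℚ) → ℚ
Σℚ f = foldr _+_ 0ℚ f

Σℚ[_] : ∀ {n} → Subset n → (Fin n → ℚ) → ℚ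
Σℚ[ W ] f = Σℚ (λ k → if lookup W k then f k else 0ℚ)

Πℕ[_] : ∀ {n} → Subset n → (Fin n → ℕ) → ℕ
Πℕ[ W ] f = foldr ℕ._*_ 1 (λ k → if lookup W k then f k else 1)

Πℕ : ∀ {n} → (Fin n → ℕ) → ℕ
Πℕ f = foldr ℕ._*_ 1 f

IsStochastic : ∀ {n} → Mat n → Set
IsStochastic P = (∀ i j → 0ℚ ≤ P i j) × (∀ i → Σℚ (λ j → P i j) ≡ 1ℚ)

matMul : ∀ {n} → Mat n → Mat n → Mat n
matMul A B i j = Σℚ (λ k → A i k * B k j)

idMat : ∀ {n} → Mat n
idMat i j = if ⌊ i ≟ j ⌋ then 1ℚ else 0ℚ

matPow : ∀ {n} → Mat n → ℕ → Mat n
matPow P zero = idMat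
matPow P (suc ℓ) = matMul (matPow P ℓ) P

-- P(X_ℓ ∉ W | X_0 = v) = Σ_{u ∉ W} (P^ℓ)_{v u}
probOutside : ∀ {n} → Mat n → Subset n → ℕ → Fin n → ℚ
probOutside P W ℓ v = Σℚ (λ u → if lookup W u then 0ℚ else matPow P ℓ v u)

-- W is open: nonempty, and for every v ∈ W, P(∃ ℓ, X_ℓ ∉ W | X_0 = v) > 0,
-- i.e. (countable union) some ℓ has P(X_ℓ ∉ W | X_0 = v) > 0.
IsOpen : ∀ {n} → Mat n → Subset n → Set
IsOpen P W = Nonempty W × (∀ v → v ∈ W → Σ ℕ (λ ℓ → 0ℚ < probOutside P W ℓ v))

-- I - P̂ restricted to W × W (entries for i, j ∈ W are the relevant ones)
IminusP : ∀ {n} → Mat n → Mat n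
IminusP P i j = idMat i j - P i j

matMulW : ∀ {n} → Subset n → Mat n → Mat n → Mat n
matMulW W A B i j = Σℚ[ W ] (λ k → A i k * B k j)

IsInverseW : ∀ {n} → Subset n → Mat n → Mat n → Set
IsInverseW W A N =
  (∀ i j → i ∈ W → j ∈ W → matMulW W A N i j ≡ idMat i j) ×
  (∀ i j → i ∈ W → j ∈ W → matMulW W N A i j ≡ idMat i j)

lcd : ∀ {m} → (Fin m → ℚ) → ℕ
lcd xs = foldr lcm 1 (λ k → ℚ.denominatorℕ (xs k))

rowLCD : ∀ {n} → Mat n → Fin n → ℕ
rowLCD P i = lcd (P i)

allLCD : ∀ {n} → Mat n → ℕ
allLCD P = foldr lcm 1 (λ i → rowLCD P i)

prodLCD : ∀ {n} → Mat n → ℕ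
prodLCD P = Πℕ (rowLCD P)

ℕ→ℚ : ℕ → ℚ
ℕ→ℚ k = (+ k) / 1

-- Eliminating the states of W one at a time by Schur complements keeps I − P̂ a weakly
-- chained diagonally dominant Z-matrix. The chains come from the escape rank r v, the least ℓ
-- with P(X_ℓ ∉ W | X₀ = v) > 0: from every v ∈ W some positive-probability step either leaves
-- W or lowers r. Hence I − P̂ has a nonnegative inverse N.
-- A column h = N e_j satisfies h = e_j + P̂ h; with m = max h and u = m − h ≥ 0 this reads
-- u + e_j = P̂ u + d m, where d is the one-step exit probability. By the maximum principle
-- u_j = 0, and every positive entry satisfies M_i P_ik ≥ 1, so induction along escape paths
-- gives m ≤ ∏_{x ∈ W, r x ≤ r i} M_x · (u_i + δ_ij); at i = j this is m ≤ ∏_{w ∈ W} M_w.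
-- Finally M_w ≤ M and W misses some state, so ∏_{w ∈ W} M_w ≤ min(D, M^{n−1}).

module Submission where

open import Defs
open import Data.Nat using (ℕ; _∸_; _^_)
open import Data.Nat as ℕ using ()
open import Data.Fin.Subset using (Subset; _∈_)
open import Data.Product using (Σ; _×_)
open import Data.Rational using (∣_∣; _≤_)

open import Algebra.Bundles using (CommutativeRing)
open import Data.Bool using (Bool; true; false; if_then_else_; not; _∧_)
import Data.Bool as Bool
open import Data.Bool.Properties using (not-injective)
open import Data.Empty using (⊥; ⊥-elim)
open import Data.Fin using (Fin; zero; suc; _≟_; punchIn)
open import Data.Fin.Properties using (any?; punchInᵢ≢i)
open import Data.Fin.Subset.Properties using (_∈?_)
import Data.Integer as ℤ
import Data.Integer.Properties as ℤP
open import Data.List using (List; []; _∷_; allFin)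
open import Data.List.Membership.Propositional using () renaming (_∈_ to _∈ₗ_)
open import Data.List.Membership.Propositional.Properties using (∈-allFin)
import Data.List.Relation.Unary.All as ListAll
open import Data.List.Relation.Unary.Any using (here; there)
open import Data.Nat.Coprimality as Coprime using (1-coprimeTo)
open import Data.Nat.Divisibility using (_∣_; ∣⇒≤; ∣-trans)
open import Data.Nat.GCD using (gcd)
open import Data.Nat.Induction using (<-wellFounded)
open import Data.Nat.LCM using (lcm; m∣lcm[m,n]; n∣lcm[m,n]; gcd*lcm)
import Data.Nat.Properties as ℕP
open import Data.Product using (∃; _,_; proj₁; proj₂)
open import Data.Rational as ℚ using (ℚ; mkℚ; 0ℚ; 1ℚ; _+_; _*_; _-_; -_; _<_)
open import Data.Rational.Properties as ℚP using ()
open import Data.Rational.Solver using (module +-*-Solver)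
import Data.Rational.Unnormalised as ℚᵘ
import Data.Rational.Unnormalised.Properties as ℚᵘP
open import Data.Sum using (_⊎_; inj₁; inj₂)
open import Data.Vec using (lookup)
open import Data.Vec.Functional using (removeAt; foldr)
open import Data.Vec.Properties using ([]=⇒lookup; lookup⇒[]=)
open import Function using (_∘_)
open import Induction.WellFounded as WF using ()
open import Relation.Binary.Bundles using (DecTotalOrder)
import Relation.Binary.Construct.On as On
open import Relation.Binary.PropositionalEquality
open import Relation.Nullary using (¬_; Dec; yes; no; _×-dec_)
open import Relation.Nullary.Decidable using (⌊_⌋)
open import Relation.Unary using (Decidable)
import Data.List.Extrema (DecTotalOrder.totalOrder ℚP.≤-decTotalOrder) as Extrema

open +-*-Solver
open import Algebra.Properties.Semiring.Sum (CommutativeRing.semiring ℚP.+-*-commutativeRing)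
  using (sum; sum-cong-≗; sum-remove; ∑-distrib-+; ∑-comm; *-distribˡ-sum; sum-replicate-zero)

private variable n : ℕ

module _ {p q : ℚ} where

  nonNeg*nonNeg : 0ℚ ≤ p → 0ℚ ≤ q → 0ℚ ≤ p * q
  nonNeg*nonNeg 0≤p 0≤q = ℚP.nonNegative⁻¹ _ {{ℚP.nonNeg*nonNeg⇒nonNeg p {{ℚ.nonNegative 0≤p}} q {{ℚ.nonNegative 0≤q}}}}

  nonPos*nonNeg : p ≤ 0ℚ → 0ℚ ≤ q → p * q ≤ 0ℚ
  nonPos*nonNeg p≤0 0≤q = ℚP.nonPositive⁻¹ _ {{ℚP.nonPos*nonNeg⇒nonPos p {{ℚ.nonPositive p≤0}} q {{ℚ.nonNegative 0≤q}}}}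

  nonNeg*nonPos : 0ℚ ≤ p → q ≤ 0ℚ → p * q ≤ 0ℚ
  nonNeg*nonPos 0≤p q≤0 = ℚP.nonPositive⁻¹ _ {{ℚP.nonNeg*nonPos⇒nonPos p {{ℚ.nonNegative 0≤p}} q {{ℚ.nonPositive q≤0}}}}

  nonPos*nonPos : p ≤ 0ℚ → q ≤ 0ℚ → 0ℚ ≤ p * q
  nonPos*nonPos p≤0 q≤0 = ℚP.nonNegative⁻¹ _ {{ℚP.nonPos*nonPos⇒nonPos p {{ℚ.nonPositive p≤0}} q {{ℚ.nonPositive q≤0}}}}

  pos*pos : 0ℚ < p → 0ℚ < q → 0ℚ < p * q
  pos*pos 0<p 0<q = ℚP.positive⁻¹ _ {{ℚP.pos*pos⇒pos p {{ℚ.positive 0<p}} q {{ℚ.positive 0<q}}}}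

  pos*neg : 0ℚ < p → q < 0ℚ → p * q < 0ℚ
  pos*neg 0<p q<0 = ℚP.negative⁻¹ _ {{ℚP.pos*neg⇒neg p {{ℚ.positive 0<p}} q {{ℚ.negative q<0}}}}

  pos-factors : 0ℚ ≤ p → 0ℚ ≤ q → 0ℚ < p * q → 0ℚ < p × 0ℚ < q
  pos-factors 0≤p 0≤q 0<pq with 0ℚ ℚP.<? p | 0ℚ ℚP.<? q
  ... | yes 0<p | yes 0<q = 0<p , 0<q
  ... | no 0≮p | _ = ⊥-elim (ℚP.<-irrefl refl (ℚP.<-≤-trans 0<pq (nonPos*nonNeg (ℚP.≮⇒≥ 0≮p) 0≤q)))
  ... | _ | no 0≮q = ⊥-elim (ℚP.<-irrefl refl (ℚP.<-≤-trans 0<pq (nonNeg*nonPos 0≤p (ℚP.≮⇒≥ 0≮q))))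

*-monoˡ-≤ : ∀ {r p q} → 0ℚ ≤ r → p ≤ q → r * p ≤ r * q
*-monoˡ-≤ {r} 0≤r = ℚP.*-monoˡ-≤-nonNeg r {{ℚ.nonNegative 0≤r}}

*-monoʳ-≤ : ∀ {r p q} → 0ℚ ≤ r → p ≤ q → p * r ≤ q * r
*-monoʳ-≤ {r} 0≤r = ℚP.*-monoʳ-≤-nonNeg r {{ℚ.nonNegative 0≤r}}

p≤p+q : ∀ {p q} → 0ℚ ≤ q → p ≤ p + q
p≤p+q {p} {q} 0≤q = subst (_≤ p + q) (ℚP.+-identityʳ p) (ℚP.+-monoʳ-≤ p 0≤q)

p≤q+p : ∀ {p q} → 0ℚ ≤ q → p ≤ q + p
p≤q+p {p} {q} 0≤q = subst (_≤ q + p) (ℚP.+-identityˡ p) (ℚP.+-monoˡ-≤ p 0≤q)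

p+q≤p : ∀ {p q} → q ≤ 0ℚ → p + q ≤ p
p+q≤p {p} {q} q≤0 = subst (p + q ≤_) (ℚP.+-identityʳ p) (ℚP.+-monoʳ-≤ p q≤0)

p+q<p : ∀ {p q} → q < 0ℚ → p + q < p
p+q<p {p} {q} q<0 = subst (p + q <_) (ℚP.+-identityʳ p) (ℚP.+-monoʳ-< p q<0)

x≤a*x : ∀ {a x} → 1ℚ ≤ a → 0ℚ ≤ x → x ≤ a * x
x≤a*x {a} {x} 1≤a 0≤x = subst (_≤ a * x) (ℚP.*-identityˡ x) (*-monoʳ-≤ 0≤x 1≤a)

private
  canonical : ℕ → ℚ
  canonical k = mkℚ (ℤ.+ k) 0 (Coprime.sym (1-coprimeTo k))

  ℕ→ℚ≡canonical : ∀ k → ℕ→ℚ k ≡ canonical k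
  ℕ→ℚ≡canonical k = ℚP.normalize-coprime (Coprime.sym (1-coprimeTo k))

ℕ→ℚ-mono-≤ : ∀ {a b} → a ℕ.≤ b → ℕ→ℚ a ≤ ℕ→ℚ b
ℕ→ℚ-mono-≤ {a} {b} a≤b rewrite ℕ→ℚ≡canonical a | ℕ→ℚ≡canonical b = ℚ.*≤* (ℤP.*-monoʳ-≤-nonNeg (ℤ.+ 1) (ℤ.+≤+ a≤b))

ℕ→ℚ-nonNeg : ∀ k → 0ℚ ≤ ℕ→ℚ k
ℕ→ℚ-nonNeg k = ℕ→ℚ-mono-≤ {0} {k} ℕ.z≤n

ℕ→ℚ-homo-* : ∀ a b → ℕ→ℚ (a ℕ.* b) ≡ ℕ→ℚ a * ℕ→ℚ b
ℕ→ℚ-homo-* a b rewrite ℕ→ℚ≡canonical a | ℕ→ℚ≡canonical b | ℕ→ℚ≡canonical (a ℕ.* b) =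
  ℚP.toℚᵘ-injective (ℚᵘP.≃-trans (ℚᵘ.*≡* (cong (ℤ._* ℤ.+ 1) (ℤP.pos-* a b))) (ℚᵘP.≃-sym (ℚP.toℚᵘ-homo-* (canonical a) (canonical b))))

1≤multiple-of-denominator : ∀ {M} .{{_ : ℕ.NonZero M}} {q} → 0ℚ < q → ℚ.denominatorℕ q ∣ M → 1ℚ ≤ ℕ→ℚ M * q
1≤multiple-of-denominator {M} {q@(mkℚ ℤ.+[1+ p ] d-1 _)} _ d∣M rewrite ℕ→ℚ≡canonical M =
  ℚP.toℚᵘ-cancel-≤ (ℚᵘP.≤-respʳ-≃ (ℚᵘP.≃-sym (ℚP.toℚᵘ-homo-* (canonical M) q)) (ℚᵘ.*≤* cross-multiplied))
  where
  cross-multiplied : ℤ.+ 1 ℤ.* ℤ.+ (1 ℕ.* ℕ.suc d-1) ℤ.≤ (ℤ.+ M ℤ.* ℤ.+[1+ p ]) ℤ.* ℤ.+ 1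
  cross-multiplied rewrite ℤP.*-identityˡ (ℤ.+ (1 ℕ.* ℕ.suc d-1)) | ℤP.*-identityʳ (ℤ.+ M ℤ.* ℤ.+[1+ p ])
                         | sym (ℤP.pos-* M (ℕ.suc p)) | ℕP.*-identityˡ (ℕ.suc d-1)
    = ℤ.+≤+ (ℕP.≤-trans (∣⇒≤ d∣M) (ℕP.m≤m*n M (ℕ.suc p)))
1≤multiple-of-denominator {q = mkℚ (ℤ.+ 0) _ _} (ℚ.*<* (ℤ.+<+ ())) _
1≤multiple-of-denominator {q = mkℚ ℤ.-[1+ _ ] _ _} (ℚ.*<* ()) _

least-witness : ∀ {p} {Q : ℕ → Set p} → Decidable Q → ∀ {L} → Q L → ∃ λ ℓ → Q ℓ × (∀ {k} → Q k → ℓ ℕ.≤ k)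
least-witness Q? {ℕ.zero} Q0 = 0 , Q0 , λ _ → ℕ.z≤n
least-witness {Q = Q} Q? {ℕ.suc L} QL with Q? 0
... | yes Q0 = 0 , Q0 , λ _ → ℕ.z≤n
... | no ¬Q0 with least-witness (Q? ∘ ℕ.suc) QL
...   | ℓ , Qℓ , least = ℕ.suc ℓ , Qℓ , above
  where
  above : ∀ {k} → Q k → ℕ.suc ℓ ℕ.≤ k
  above {ℕ.zero} Q0 = ⊥-elim (¬Q0 Q0)
  above {ℕ.suc k} Qk = ℕ.s≤s (least Qk)

rank-≢ : ∀ {a} {A : Set a} (r : A → ℕ) {x y} → r x ℕ.< r y → x ≢ y
rank-≢ r rx<ry refl = ℕP.<-irrefl refl rx<ry

rank-induction : ∀ {a p} {A : Set a} (r : A → ℕ) (Q : A → Set p) →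
  (∀ x → (∀ {y} → r y ℕ.< r x → Q y) → Q x) → ∀ x → Q x
rank-induction r Q = WF.All.wfRec (On.wellFounded r <-wellFounded) _ Q

Σ⟨_⟩ : (Fin n → Bool) → (Fin n → ℚ) → ℚ
Σ⟨ S ⟩ f = sum (λ k → if S k then f k else 0ℚ)

delete : Fin n → (Fin n → Bool) → (Fin n → Bool)
delete w S k = if ⌊ k ≟ w ⌋ then false else S k

full : Fin n → Bool
full _ = true

private
  mask : (Fin n → Bool) → (Fin n → ℚ) → Fin n → ℚ
  mask S f k = if S k then f k else 0ℚ

delete-self : ∀ (w : Fin n) S → delete w S w ≡ false
delete-self w S with w ≟ w
... | yes _ = refl
... | no w≢w = ⊥-elim (w≢w refl)

delete-≢ : ∀ {k w : Fin n} S → k ≢ w → delete w S k ≡ S k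
delete-≢ {k = k} {w} S k≢w with k ≟ w
... | yes k≡w = ⊥-elim (k≢w k≡w)
... | no _ = refl

delete⇒≢ : ∀ {k w : Fin n} S → delete w S k ≡ true → k ≢ w
delete⇒≢ {k = k} {w} S k∈ k≡w with k ≟ w
delete⇒≢ S () k≡w | yes _
... | no k≢w = k≢w k≡w

delete⇒∈ : ∀ {k w : Fin n} S → delete w S k ≡ true → S k ≡ true
delete⇒∈ {k = k} {w} S k∈ with k ≟ w
delete⇒∈ S () | yes _
... | no _ = k∈

∈⇒delete : ∀ {k w : Fin n} S → k ≢ w → S k ≡ true → delete w S k ≡ true
∈⇒delete S k≢w Sk = trans (delete-≢ S k≢w) Sk

sum-mono-≤ : ∀ {f g : Fin n → ℚ} → (∀ k → f k ≤ g k) → sum f ≤ sum g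
sum-mono-≤ {n = ℕ.zero} _ = ℚP.≤-refl
sum-mono-≤ {n = ℕ.suc _} f≤g = ℚP.+-mono-≤ (f≤g zero) (sum-mono-≤ (f≤g ∘ suc))

module _ (S : Fin n → Bool) where

  Σ⟨⟩-cong : ∀ {f g} → (∀ {k} → S k ≡ true → f k ≡ g k) → Σ⟨ S ⟩ f ≡ Σ⟨ S ⟩ g
  Σ⟨⟩-cong {f} {g} f≡g = sum-cong-≗ pointwise
    where
    pointwise : ∀ k → mask S f k ≡ mask S g k
    pointwise k with S k in Sk
    ... | true = f≡g Sk
    ... | false = refl

  Σ⟨⟩-zero : Σ⟨ S ⟩ (λ _ → 0ℚ) ≡ 0ℚ
  Σ⟨⟩-zero = trans (sum-cong-≗ pointwise) (sum-replicate-zero n)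
    where
    pointwise : ∀ k → mask S (λ _ → 0ℚ) k ≡ 0ℚ
    pointwise k with S k
    ... | true = refl
    ... | false = refl

  Σ⟨⟩-distrib-+ : ∀ (f g : Fin n → ℚ) → Σ⟨ S ⟩ (λ k → f k + g k) ≡ Σ⟨ S ⟩ f + Σ⟨ S ⟩ g
  Σ⟨⟩-distrib-+ f g = trans (sum-cong-≗ pointwise) (∑-distrib-+ (mask S f) (mask S g))
    where
    pointwise : ∀ k → mask S (λ k → f k + g k) k ≡ mask S f k + mask S g k
    pointwise k with S k
    ... | true = refl
    ... | false = refl

  Σ⟨⟩-*ˡ : ∀ a (f : Fin n → ℚ) → Σ⟨ S ⟩ (λ k → a * f k) ≡ a * Σ⟨ S ⟩ f
  Σ⟨⟩-*ˡ a f = trans (sum-cong-≗ pointwise) (sym (*-distribˡ-sum a (mask S f)))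
    where
    pointwise : ∀ k → mask S (λ k → a * f k) k ≡ a * mask S f k
    pointwise k with S k
    ... | true = refl
    ... | false = sym (ℚP.*-zeroʳ a)

  Σ⟨⟩-mono-≤ : ∀ {f g} → (∀ {k} → S k ≡ true → f k ≤ g k) → Σ⟨ S ⟩ f ≤ Σ⟨ S ⟩ g
  Σ⟨⟩-mono-≤ {f} {g} f≤g = sum-mono-≤ pointwise
    where
    pointwise : ∀ k → mask S f k ≤ mask S g k
    pointwise k with S k in Sk
    ... | true = f≤g Sk
    ... | false = ℚP.≤-refl

  Σ⟨⟩-nonNeg : ∀ {f} → (∀ {k} → S k ≡ true → 0ℚ ≤ f k) → 0ℚ ≤ Σ⟨ S ⟩ f
  Σ⟨⟩-nonNeg {f} 0≤f = subst (_≤ Σ⟨ S ⟩ f) Σ⟨⟩-zero (Σ⟨⟩-mono-≤ 0≤f)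

  Σ⟨⟩-nonPos : ∀ {f} → (∀ {k} → S k ≡ true → f k ≤ 0ℚ) → Σ⟨ S ⟩ f ≤ 0ℚ
  Σ⟨⟩-nonPos {f} f≤0 = subst (Σ⟨ S ⟩ f ≤_) Σ⟨⟩-zero (Σ⟨⟩-mono-≤ f≤0)

  Σ⟨⟩-pos⇒∃ : ∀ f → 0ℚ < Σ⟨ S ⟩ f → ∃ λ k → S k ≡ true × 0ℚ < f k
  Σ⟨⟩-pos⇒∃ f 0<Σ with any? (λ k → S k Bool.≟ true ×-dec 0ℚ ℚP.<? f k)
  ... | yes found = found
  ... | no none = ⊥-elim (ℚP.<-irrefl refl (ℚP.<-≤-trans 0<Σ (Σ⟨⟩-nonPos (λ Sk → ℚP.≮⇒≥ (λ 0<fk → none (_ , Sk , 0<fk))))))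

Σ⟨⟩-split : ∀ {S : Fin n → Bool} (f : Fin n → ℚ) {w} → S w ≡ true → Σ⟨ S ⟩ f ≡ f w + Σ⟨ delete w S ⟩ f
Σ⟨⟩-split {n = ℕ.zero} _ {()}
Σ⟨⟩-split {n = ℕ.suc _} {S} f {w} Sw = begin
  sum (mask S f)                                    ≡⟨ sum-remove {i = w} (mask S f) ⟩
  mask S f w + sum (removeAt (mask S f) w)          ≡⟨ cong₂ _+_ at-w (sum-cong-≗ off-w) ⟩
  f w + sum (removeAt (mask S′ f) w)                ≡⟨ cong (f w +_) (sym (trans (cong (_+ rest) at-w′) (ℚP.+-identityˡ rest))) ⟩
  f w + (mask S′ f w + sum (removeAt (mask S′ f) w)) ≡⟨ cong (f w +_) (sym (sum-remove {i = w} (mask S′ f))) ⟩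
  f w + sum (mask S′ f)                             ∎
  where
  open ≡-Reasoning
  S′ : Fin _ → Bool
  S′ = delete w S
  rest : ℚ
  rest = sum (removeAt (mask S′ f) w)
  at-w : mask S f w ≡ f w
  at-w rewrite Sw = refl
  at-w′ : mask S′ f w ≡ 0ℚ
  at-w′ rewrite delete-self w S = refl
  off-w : ∀ k → mask S f (punchIn w k) ≡ mask S′ f (punchIn w k)
  off-w k rewrite delete-≢ {k = punchIn w k} S (punchInᵢ≢i w k) = refl

module _ (S : Fin n → Bool) where

  Σ⟨⟩-single : ∀ {f i} → S i ≡ true → (∀ {k} → S k ≡ true → k ≢ i → f k ≡ 0ℚ) → Σ⟨ S ⟩ f ≡ f i
  Σ⟨⟩-single {f} {i} Si vanish = begin
    Σ⟨ S ⟩ f                        ≡⟨ Σ⟨⟩-split f Si ⟩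
    f i + Σ⟨ delete i S ⟩ f          ≡⟨ cong (f i +_) (Σ⟨⟩-cong (delete i S) (λ k∈ → vanish (delete⇒∈ S k∈) (delete⇒≢ S k∈))) ⟩
    f i + Σ⟨ delete i S ⟩ (λ _ → 0ℚ) ≡⟨ cong (f i +_) (Σ⟨⟩-zero (delete i S)) ⟩
    f i + 0ℚ                        ≡⟨ ℚP.+-identityʳ (f i) ⟩
    f i                             ∎
    where open ≡-Reasoning

  Σ⟨⟩-≥-term : ∀ {f w} → (∀ {k} → S k ≡ true → 0ℚ ≤ f k) → S w ≡ true → f w ≤ Σ⟨ S ⟩ f
  Σ⟨⟩-≥-term {f} {w} 0≤f Sw =
    subst (f w ≤_) (sym (Σ⟨⟩-split f Sw)) (p≤p+q (Σ⟨⟩-nonNeg (delete w S) (0≤f ∘ delete⇒∈ S)))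

  Σ⟨⟩-≤-term : ∀ {f w} → (∀ {k} → S k ≡ true → f k ≤ 0ℚ) → S w ≡ true → Σ⟨ S ⟩ f ≤ f w
  Σ⟨⟩-≤-term {f} {w} f≤0 Sw =
    subst (_≤ f w) (sym (Σ⟨⟩-split f Sw)) (p+q≤p (Σ⟨⟩-nonPos (delete w S) (f≤0 ∘ delete⇒∈ S)))

private
  if-Σ⟨⟩ : ∀ (U : Fin n → Bool) b (g : Fin n → ℚ) → (if b then Σ⟨ U ⟩ g else 0ℚ) ≡ Σ⟨ U ⟩ (λ l → if b then g l else 0ℚ)
  if-Σ⟨⟩ U true g = refl
  if-Σ⟨⟩ U false g = sym (Σ⟨⟩-zero U)

Σ⟨⟩-comm : ∀ (S T : Fin n → Bool) (g : Fin n → Fin n → ℚ) →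
           Σ⟨ S ⟩ (λ k → Σ⟨ T ⟩ (g k)) ≡ Σ⟨ T ⟩ (λ l → Σ⟨ S ⟩ (λ k → g k l))
Σ⟨⟩-comm {n} S T g = begin
  Σ⟨ S ⟩ (λ k → Σ⟨ T ⟩ (g k))                          ≡⟨ sum-cong-≗ (λ k → if-Σ⟨⟩ T (S k) (g k)) ⟩
  sum (λ k → Σ⟨ T ⟩ (λ l → mask S (λ k → g k l) k))     ≡⟨ ∑-comm (λ k l → mask T (λ l → mask S (λ k → g k l) k) l) ⟩
  sum (λ l → sum (λ k → mask T (λ l → mask S (λ k → g k l) k) l)) ≡⟨ sum-cong-≗ masked-outer ⟩
  Σ⟨ T ⟩ (λ l → Σ⟨ S ⟩ (λ k → g k l))                  ∎
  where
  open ≡-Reasoning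
  masked-outer : ∀ l → sum (λ k → mask T (λ l → mask S (λ k → g k l) k) l) ≡ mask T (λ l → Σ⟨ S ⟩ (λ k → g k l)) l
  masked-outer l with T l
  ... | true = refl
  ... | false = sum-replicate-zero n

Σ⟨⟩-comm-mul : ∀ (S T : Fin n → Bool) (a b : Fin n → ℚ) (B : Mat n) →
               Σ⟨ S ⟩ (λ k → a k * Σ⟨ T ⟩ (λ l → b l * B k l)) ≡ Σ⟨ T ⟩ (λ l → b l * Σ⟨ S ⟩ (λ k → a k * B k l))
Σ⟨⟩-comm-mul S T a b B = begin
  Σ⟨ S ⟩ (λ k → a k * Σ⟨ T ⟩ (λ l → b l * B k l))   ≡⟨ Σ⟨⟩-cong S (λ {k} _ → sym (Σ⟨⟩-*ˡ T (a k) _)) ⟩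
  Σ⟨ S ⟩ (λ k → Σ⟨ T ⟩ (λ l → a k * (b l * B k l))) ≡⟨ Σ⟨⟩-comm S T _ ⟩
  Σ⟨ T ⟩ (λ l → Σ⟨ S ⟩ (λ k → a k * (b l * B k l))) ≡⟨ Σ⟨⟩-cong T (λ {l} _ → Σ⟨⟩-cong S (λ {k} _ → exchange (a k) (b l) (B k l))) ⟩
  Σ⟨ T ⟩ (λ l → Σ⟨ S ⟩ (λ k → b l * (a k * B k l))) ≡⟨ Σ⟨⟩-cong T (λ {l} _ → Σ⟨⟩-*ˡ S (b l) _) ⟩
  Σ⟨ T ⟩ (λ l → b l * Σ⟨ S ⟩ (λ k → a k * B k l))   ∎
  where
  open ≡-Reasoning
  exchange : ∀ x y z → x * (y * z) ≡ y * (x * z)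
  exchange = solve 3 (λ x y z → x :* (y :* z) := y :* (x :* z)) refl

Σ⟨⟩-complement : ∀ (S : Fin n → Bool) (f : Fin n → ℚ) → sum f ≡ Σ⟨ S ⟩ f + Σ⟨ not ∘ S ⟩ f
Σ⟨⟩-complement S f = trans (sum-cong-≗ pointwise) (∑-distrib-+ (mask S f) (mask (not ∘ S) f))
  where
  pointwise : ∀ k → f k ≡ mask S f k + mask (not ∘ S) f k
  pointwise k with S k
  ... | true = sym (ℚP.+-identityʳ (f k))
  ... | false = sym (ℚP.+-identityˡ (f k))

Σ⟨⟩-sub-* : ∀ (S : Fin n → Bool) a (f g : Fin n → ℚ) → Σ⟨ S ⟩ (λ k → f k - a * g k) ≡ Σ⟨ S ⟩ f - a * Σ⟨ S ⟩ g
Σ⟨⟩-sub-* S a f g = begin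
  Σ⟨ S ⟩ (λ k → f k - a * g k)             ≡⟨ Σ⟨⟩-cong S (λ {k} _ → solve 3 (λ a f g → f :- a :* g := f :+ (:- a) :* g) refl a (f k) (g k)) ⟩
  Σ⟨ S ⟩ (λ k → f k + (- a) * g k)          ≡⟨ Σ⟨⟩-distrib-+ S f _ ⟩
  Σ⟨ S ⟩ f + Σ⟨ S ⟩ (λ k → (- a) * g k)     ≡⟨ cong (Σ⟨ S ⟩ f +_) (Σ⟨⟩-*ˡ S (- a) g) ⟩
  Σ⟨ S ⟩ f + (- a) * Σ⟨ S ⟩ g               ≡⟨ solve 3 (λ a x y → x :+ (:- a) :* y := x :- a :* y) refl a (Σ⟨ S ⟩ f) (Σ⟨ S ⟩ g) ⟩
  Σ⟨ S ⟩ f - a * Σ⟨ S ⟩ g                   ∎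
  where open ≡-Reasoning

argmax-on : ∀ (S : Fin n → Bool) (f : Fin n → ℚ) {j} → S j ≡ true → ∃ λ i → S i ≡ true × (∀ {k} → S k ≡ true → f k ≤ f i)
argmax-on {n} S f {j} Sj = pick (S i) refl
  where
  f′ : Fin n → ℚ
  f′ k = if S k then f k else f j
  i : Fin n
  i = Extrema.argmax f′ j (allFin n)
  f′≤f′[i] : ∀ k → f′ k ≤ f′ i
  f′≤f′[i] k = ListAll.lookup (Extrema.f[xs]≤f[argmax] j (allFin n)) (∈-allFin k)
  f′-on-S : ∀ {k} → S k ≡ true → f′ k ≡ f k
  f′-on-S Sk rewrite Sk = refl
  pick : ∀ b → S i ≡ b → ∃ λ i → S i ≡ true × (∀ {k} → S k ≡ true → f k ≤ f i)
  pick true Si = i , Si , λ {k} Sk → subst₂ _≤_ (f′-on-S Sk) (f′-on-S Si) (f′≤f′[i] k)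
  pick false Si = j , Sj , λ {k} Sk → subst₂ _≤_ (f′-on-S Sk) f′[i]≡f[j] (f′≤f′[i] k)
    where
    f′[i]≡f[j] : f′ i ≡ f j
    f′[i]≡f[j] rewrite Si = refl

Π⟨_⟩ : (Fin n → Bool) → (Fin n → ℕ) → ℕ
Π⟨ S ⟩ f = foldr ℕ._*_ 1 (λ k → if S k then f k else 1)

private
  factor-mono : ∀ {f : Fin n → ℕ} → (∀ k → 1 ℕ.≤ f k) → ∀ {S T : Fin n → Bool} k →
                (S k ≡ true → T k ≡ true) → (if S k then f k else 1) ℕ.≤ (if T k then f k else 1)
  factor-mono _ {S} {T} k S⇒T with S k | T k | S⇒T
  ... | true  | true  | _ = ℕP.≤-refl
  ... | true  | false | S⇒T′ with S⇒T′ refl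
  ...   | ()
  factor-mono 1≤f k _ | false | true  | _ = 1≤f k
  factor-mono 1≤f k _ | false | false | _ = ℕP.≤-refl

  foldr-*-mono : ∀ {g h : Fin n → ℕ} → (∀ k → g k ℕ.≤ h k) → foldr ℕ._*_ 1 g ℕ.≤ foldr ℕ._*_ 1 h
  foldr-*-mono {n = ℕ.zero} _ = ℕP.≤-refl
  foldr-*-mono {n = ℕ.suc _} g≤h = ℕP.*-mono-≤ (g≤h zero) (foldr-*-mono (g≤h ∘ suc))

Π⟨⟩-mono-⊆ : ∀ {f : Fin n → ℕ} → (∀ k → 1 ℕ.≤ f k) → ∀ {S T : Fin n → Bool} →
             (∀ {k} → S k ≡ true → T k ≡ true) → Π⟨ S ⟩ f ℕ.≤ Π⟨ T ⟩ f
Π⟨⟩-mono-⊆ 1≤f {S} {T} S⊆T = foldr-*-mono (λ k → factor-mono 1≤f {S} {T} k S⊆T)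

Π⟨⟩-insert : ∀ {f : Fin n → ℕ} → (∀ k → 1 ℕ.≤ f k) → ∀ {S T : Fin n → Bool} {i} →
  S i ≡ false → T i ≡ true → (∀ {k} → S k ≡ true → T k ≡ true) → f i ℕ.* Π⟨ S ⟩ f ℕ.≤ Π⟨ T ⟩ f
Π⟨⟩-insert {n = ℕ.suc _} {f} 1≤f {S} {T} {zero} Si Ti S⊆T rewrite Si | Ti =
  ℕP.*-monoʳ-≤ (f zero) (ℕP.≤-trans (ℕP.≤-reflexive (ℕP.*-identityˡ _)) (Π⟨⟩-mono-⊆ (1≤f ∘ suc) {S ∘ suc} {T ∘ suc} S⊆T))
Π⟨⟩-insert {n = ℕ.suc _} {f} 1≤f {S} {T} {suc i} Si Ti S⊆T = begin
  f (suc i) ℕ.* (head S ℕ.* tail S)  ≡⟨ ℕP.*-assoc (f (suc i)) (head S) (tail S) ⟨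
  f (suc i) ℕ.* head S ℕ.* tail S    ≡⟨ cong (ℕ._* tail S) (ℕP.*-comm (f (suc i)) (head S)) ⟩
  head S ℕ.* f (suc i) ℕ.* tail S    ≡⟨ ℕP.*-assoc (head S) (f (suc i)) (tail S) ⟩
  head S ℕ.* (f (suc i) ℕ.* tail S)  ≤⟨ ℕP.*-mono-≤ (factor-mono 1≤f {S} {T} zero S⊆T) (Π⟨⟩-insert (1≤f ∘ suc) {S ∘ suc} {T ∘ suc} Si Ti S⊆T) ⟩
  head T ℕ.* tail T                  ∎
  where
  open ℕP.≤-Reasoning
  head tail : (Fin _ → Bool) → ℕ
  head U = if U zero then f zero else 1
  tail U = Π⟨ U ∘ suc ⟩ (f ∘ suc)

private
  factor≤ : ∀ {S : Fin n → Bool} {f : Fin n → ℕ} {B} → 1 ℕ.≤ B → (∀ {k} → S k ≡ true → f k ℕ.≤ B) →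
            ∀ k → (if S k then f k else 1) ℕ.≤ B
  factor≤ {S = S} 1≤B f≤B k with S k in Sk
  ... | true = f≤B Sk
  ... | false = 1≤B

  Π⟨⟩-≤-^ : ∀ {S : Fin n → Bool} {f : Fin n → ℕ} {B} → 1 ℕ.≤ B → (∀ {k} → S k ≡ true → f k ℕ.≤ B) →
            Π⟨ S ⟩ f ℕ.≤ B ^ n
  Π⟨⟩-≤-^ {n = ℕ.zero} _ _ = ℕP.≤-refl
  Π⟨⟩-≤-^ {n = ℕ.suc _} {S} {f} 1≤B f≤B =
    ℕP.*-mono-≤ (factor≤ {S = S} {f} 1≤B f≤B zero) (Π⟨⟩-≤-^ {S = S ∘ suc} {f ∘ suc} 1≤B f≤B)

Π⟨⟩-≤-^∸1 : ∀ {S : Fin n → Bool} {f : Fin n → ℕ} {B u} → S u ≡ false → 1 ℕ.≤ B →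
            (∀ {k} → S k ≡ true → f k ℕ.≤ B) → Π⟨ S ⟩ f ℕ.≤ B ^ (n ∸ 1)
Π⟨⟩-≤-^∸1 {n = ℕ.suc _} {S} {f} {u = zero} Su 1≤B f≤B rewrite Su =
  ℕP.≤-trans (ℕP.≤-reflexive (ℕP.*-identityˡ _)) (Π⟨⟩-≤-^ {S = S ∘ suc} {f ∘ suc} 1≤B f≤B)
Π⟨⟩-≤-^∸1 {n = ℕ.suc (ℕ.suc _)} {S} {f} {u = suc _} Su 1≤B f≤B =
  ℕP.*-mono-≤ (factor≤ {S = S} {f} 1≤B f≤B zero) (Π⟨⟩-≤-^∸1 {S = S ∘ suc} {f ∘ suc} Su 1≤B f≤B)

Π⟨∅⟩ : ∀ (f : Fin n → ℕ) → Π⟨ (λ _ → false) ⟩ f ≡ 1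
Π⟨∅⟩ {n = ℕ.zero} f = refl
Π⟨∅⟩ {n = ℕ.suc _} f = trans (ℕP.*-identityˡ _) (Π⟨∅⟩ (f ∘ suc))

Π⟨⟩-≥-factor : ∀ {f : Fin n → ℕ} → (∀ k → 1 ℕ.≤ f k) → ∀ {T : Fin n → Bool} {i} → T i ≡ true → f i ℕ.≤ Π⟨ T ⟩ f
Π⟨⟩-≥-factor {f = f} 1≤f {T} {i} Ti = begin
  f i                                  ≡⟨ ℕP.*-identityʳ (f i) ⟨
  f i ℕ.* 1                            ≡⟨ cong (f i ℕ.*_) (Π⟨∅⟩ f) ⟨
  f i ℕ.* Π⟨ (λ _ → false) ⟩ f         ≤⟨ Π⟨⟩-insert 1≤f refl Ti (λ ()) ⟩
  Π⟨ T ⟩ f                             ∎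
  where open ℕP.≤-Reasoning

private
  lcm-pos : ∀ {a b} → 0 ℕ.< a → 0 ℕ.< b → 0 ℕ.< lcm a b
  lcm-pos {a} {b} 0<a 0<b with lcm a b | gcd*lcm a b
  ... | ℕ.zero | gcd*0≡a*b = ⊥-elim (ℕP.<-irrefl (trans (sym (ℕP.*-zeroʳ (gcd a b))) gcd*0≡a*b) (ℕP.*-mono-< 0<a 0<b))
  ... | ℕ.suc _ | _ = ℕ.s≤s ℕ.z≤n

  foldr-lcm-pos : ∀ (g : Fin n → ℕ) → (∀ k → 0 ℕ.< g k) → 0 ℕ.< foldr lcm 1 g
  foldr-lcm-pos {n = ℕ.zero} g _ = ℕ.s≤s ℕ.z≤n
  foldr-lcm-pos {n = ℕ.suc _} g 0<g = lcm-pos (0<g zero) (foldr-lcm-pos (g ∘ suc) (0<g ∘ suc))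

  foldr-lcm-∣ : ∀ (g : Fin n → ℕ) k → g k ∣ foldr lcm 1 g
  foldr-lcm-∣ {n = ℕ.suc _} g zero = m∣lcm[m,n] (g zero) _
  foldr-lcm-∣ {n = ℕ.suc _} g (suc k) = ∣-trans (foldr-lcm-∣ (g ∘ suc) k) (n∣lcm[m,n] (g zero) _)

module _ (P : Mat n) where

  rowLCD-pos : ∀ i → 0 ℕ.< rowLCD P i
  rowLCD-pos i = foldr-lcm-pos (λ k → ℚ.denominatorℕ (P i k)) (λ _ → ℕ.s≤s ℕ.z≤n)

  allLCD-pos : 0 ℕ.< allLCD P
  allLCD-pos = foldr-lcm-pos (rowLCD P) rowLCD-pos

  rowLCD≤allLCD : ∀ i → rowLCD P i ℕ.≤ allLCD P
  rowLCD≤allLCD i = ∣⇒≤ {{ℕ.>-nonZero allLCD-pos}} (foldr-lcm-∣ (rowLCD P) i)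

  rowLCD-clears : ∀ {i k} → 0ℚ < P i k → 1ℚ ≤ ℕ→ℚ (rowLCD P i) * P i k
  rowLCD-clears {i} {k} 0<Pik =
    1≤multiple-of-denominator {{ℕ.>-nonZero (rowLCD-pos i)}} 0<Pik (foldr-lcm-∣ (λ k → ℚ.denominatorℕ (P i k)) k)

_ᵀ : Mat n → Mat n
(A ᵀ) i j = A j i

idMat-diag : ∀ (i : Fin n) → idMat i i ≡ 1ℚ
idMat-diag i with i ≟ i
... | yes _ = refl
... | no i≢i = ⊥-elim (i≢i refl)

idMat-≢ : ∀ {i j : Fin n} → i ≢ j → idMat i j ≡ 0ℚ
idMat-≢ {i = i} {j} i≢j with i ≟ j
... | yes i≡j = ⊥-elim (i≢j i≡j)
... | no _ = refl

idMat-sym : ∀ (i j : Fin n) → idMat i j ≡ idMat j i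
idMat-sym i j with i ≟ j
... | yes refl = sym (idMat-diag i)
... | no i≢j = sym (idMat-≢ (i≢j ∘ sym))

idMat-nonNeg : ∀ (i j : Fin n) → 0ℚ ≤ idMat i j
idMat-nonNeg i j with ⌊ i ≟ j ⌋
... | true = ℚP.<⇒≤ (ℚP.positive⁻¹ 1ℚ)
... | false = ℚP.≤-refl

Σ⟨⟩-idMatˡ : ∀ (S : Fin n → Bool) {i} (f : Fin n → ℚ) → S i ≡ true → Σ⟨ S ⟩ (λ k → idMat i k * f k) ≡ f i
Σ⟨⟩-idMatˡ S {i} f Si = begin
  Σ⟨ S ⟩ (λ k → idMat i k * f k) ≡⟨ Σ⟨⟩-single S Si (λ {k} _ k≢i → trans (cong (_* f k) (idMat-≢ (k≢i ∘ sym))) (ℚP.*-zeroˡ (f k))) ⟩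
  idMat i i * f i                ≡⟨ cong (_* f i) (idMat-diag i) ⟩
  1ℚ * f i                       ≡⟨ ℚP.*-identityˡ (f i) ⟩
  f i                            ∎
  where open ≡-Reasoning

Σ⟨⟩-idMatʳ : ∀ (S : Fin n → Bool) {j} (f : Fin n → ℚ) → S j ≡ true → Σ⟨ S ⟩ (λ k → f k * idMat k j) ≡ f j
Σ⟨⟩-idMatʳ S {j} f Sj = begin
  Σ⟨ S ⟩ (λ k → f k * idMat k j) ≡⟨ Σ⟨⟩-single S Sj (λ {k} _ k≢j → trans (cong (f k *_) (idMat-≢ k≢j)) (ℚP.*-zeroʳ (f k))) ⟩
  f j * idMat j j                ≡⟨ cong (f j *_) (idMat-diag j) ⟩
  f j * 1ℚ                       ≡⟨ ℚP.*-identityʳ (f j) ⟩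
  f j                            ∎
  where open ≡-Reasoning

IsLeftInverseOn : (Fin n → Bool) → Mat n → Mat n → Set
IsLeftInverseOn S A N = ∀ {i j} → S i ≡ true → S j ≡ true → Σ⟨ S ⟩ (λ k → A i k * N k j) ≡ idMat i j

IsInverseOn : (Fin n → Bool) → Mat n → Mat n → Set
IsInverseOn S A N = IsLeftInverseOn S A N × IsLeftInverseOn S (A ᵀ) (N ᵀ)

IsLeftInverseOn-cong : ∀ {S : Fin n → Bool} {A A′ N N′ : Mat n} →
  (∀ {i j} → S i ≡ true → S j ≡ true → A i j ≡ A′ i j) →
  (∀ {i j} → S i ≡ true → S j ≡ true → N i j ≡ N′ i j) →
  IsLeftInverseOn S A N → IsLeftInverseOn S A′ N′
IsLeftInverseOn-cong {S = S} A≡A′ N≡N′ inv Si Sj =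
  trans (Σ⟨⟩-cong S (λ Sk → sym (cong₂ _*_ (A≡A′ Si Sk) (N≡N′ Sk Sj)))) (inv Si Sj)

schurComplement : Mat n → Fin n → ℚ → Mat n
schurComplement A w c i j = A i j - A i w * c * A w j

module _ {S : Fin n → Bool} {A : Mat n} {w : Fin n} {c : ℚ} (Sw : S w ≡ true) (pivot : c * A w w ≡ 1ℚ) where

  private
    cancel-pivot : ∀ a b → a * c * (A w w * b) ≡ a * b
    cancel-pivot a b = begin
      a * c * (A w w * b)   ≡⟨ solve 4 (λ a c d b → a :* c :* (d :* b) := a :* (c :* d) :* b) refl a c (A w w) b ⟩
      a * (c * A w w) * b   ≡⟨ cong (λ p → a * p * b) pivot ⟩
      a * 1ℚ * b            ≡⟨ solve 2 (λ a b → a :* con 1ℚ :* b := a :* b) refl a b ⟩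
      a * b                 ∎
      where open ≡-Reasoning

  Σ⟨⟩-eliminate : ∀ (x : Fin n → ℚ) i →
    Σ⟨ S ⟩ (λ k → A i k * x k) ≡
    Σ⟨ delete w S ⟩ (λ k → schurComplement A w c i k * x k) + A i w * c * Σ⟨ S ⟩ (λ k → A w k * x k)
  Σ⟨⟩-eliminate x i = begin
    Σ⟨ S ⟩ (λ k → A i k * x k)
      ≡⟨ Σ⟨⟩-split (λ k → A i k * x k) Sw ⟩
    A i w * x w + X
      ≡⟨ cong (_+ X) (cancel-pivot (A i w) (x w)) ⟨
    A i w * c * (A w w * x w) + X
      ≡⟨ solve 5 (λ a c e X Y → a :* c :* e :+ X := (X :- a :* c :* Y) :+ a :* c :* (e :+ Y)) refl (A i w) c (A w w * x w) X Y ⟩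
    (X - A i w * c * Y) + A i w * c * (A w w * x w + Y)
      ≡⟨ cong₂ _+_ eliminated (cong (A i w * c *_) (Σ⟨⟩-split (λ k → A w k * x k) Sw)) ⟨
    Σ⟨ delete w S ⟩ (λ k → schurComplement A w c i k * x k) + A i w * c * Σ⟨ S ⟩ (λ k → A w k * x k) ∎
    where
    open ≡-Reasoning
    X Y : ℚ
    X = Σ⟨ delete w S ⟩ (λ k → A i k * x k)
    Y = Σ⟨ delete w S ⟩ (λ k → A w k * x k)
    eliminated : Σ⟨ delete w S ⟩ (λ k → schurComplement A w c i k * x k) ≡ X - A i w * c * Y
    eliminated = trans
      (Σ⟨⟩-cong (delete w S) (λ {k} _ → solve 5 (λ a b e d x → (a :- b :* e :* d) :* x := a :* x :- b :* e :* (d :* x)) refl (A i k) (A i w) c (A w k) (x k)))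
      (Σ⟨⟩-sub-* (delete w S) (A i w * c) _ _)


module SchurInverse (S : Fin n → Bool) (A : Mat n) (w : Fin n) (c : ℚ) (N′ : Mat n) where

  S′ : Fin n → Bool
  S′ = delete w S

  corner : ℚ
  corner = c + c * Σ⟨ S′ ⟩ (λ k → A w k * Σ⟨ S′ ⟩ (λ l → A l w * N′ k l)) * c

  -- Block inversion at the pivot w, with c = (A w w)⁻¹, b = A w · and d = A · w restricted to S′:
  -- [ c + c (b N′ d) c , - c (b N′) ; - c (N′ d) , N′ ].
  schurInverse : Mat n
  schurInverse i j with i ≟ w | j ≟ w
  ... | yes _ | yes _ = corner
  ... | yes _ | no _  = - (c * Σ⟨ S′ ⟩ (λ k → A w k * N′ k j))
  ... | no _  | yes _ = - (c * Σ⟨ S′ ⟩ (λ k → A k w * N′ i k))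
  ... | no _  | no _  = N′ i j

  schurInverse-ww : schurInverse w w ≡ corner
  schurInverse-ww with w ≟ w
  ... | yes _ = refl
  ... | no w≢w = ⊥-elim (w≢w refl)

  schurInverse-wj : ∀ {j} → j ≢ w → schurInverse w j ≡ - (c * Σ⟨ S′ ⟩ (λ k → A w k * N′ k j))
  schurInverse-wj {j} j≢w with w ≟ w | j ≟ w
  ... | no w≢w | _ = ⊥-elim (w≢w refl)
  ... | yes _ | yes j≡w = ⊥-elim (j≢w j≡w)
  ... | yes _ | no _ = refl

  schurInverse-iw : ∀ {i} → i ≢ w → schurInverse i w ≡ - (c * Σ⟨ S′ ⟩ (λ k → A k w * N′ i k))
  schurInverse-iw {i} i≢w with i ≟ w | w ≟ w
  ... | _ | no w≢w = ⊥-elim (w≢w refl)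
  ... | yes i≡w | yes _ = ⊥-elim (i≢w i≡w)
  ... | no _ | yes _ = refl

  schurInverse-ij : ∀ {i j} → i ≢ w → j ≢ w → schurInverse i j ≡ N′ i j
  schurInverse-ij {i} {j} i≢w j≢w with i ≟ w | j ≟ w
  ... | yes i≡w | _ = ⊥-elim (i≢w i≡w)
  ... | no _ | yes j≡w = ⊥-elim (j≢w j≡w)
  ... | no _ | no _ = refl

  module _ (Sw : S w ≡ true) (pivot : c * A w w ≡ 1ℚ) (N′-inv : IsLeftInverseOn S′ (schurComplement A w c) N′) where

    private
      N : Mat n
      N = schurInverse
      Z : ℚ
      Z = Σ⟨ S′ ⟩ (λ k → A w k * Σ⟨ S′ ⟩ (λ l → A l w * N′ k l))

    schurInverse-row-w : ∀ {j} → Dec (j ≡ w) → Σ⟨ S ⟩ (λ k → A w k * N k j) ≡ idMat w j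
    schurInverse-row-w (yes refl) = begin
      Σ⟨ S ⟩ (λ k → A w k * N k w)
        ≡⟨ Σ⟨⟩-split (λ k → A w k * N k w) Sw ⟩
      A w w * N w w + Σ⟨ S′ ⟩ (λ k → A w k * N k w)
        ≡⟨ cong₂ _+_ (cong (A w w *_) schurInverse-ww) column-w ⟩
      A w w * corner + (- c) * Z
        ≡⟨ solve 3 (λ d c Z → d :* (c :+ c :* Z :* c) :+ (:- c) :* Z := (c :* d) :* (con 1ℚ :+ Z :* c) :- c :* Z) refl (A w w) c Z ⟩
      (c * A w w) * (1ℚ + Z * c) - c * Z
        ≡⟨ cong (λ p → p * (1ℚ + Z * c) - c * Z) pivot ⟩
      1ℚ * (1ℚ + Z * c) - c * Z
        ≡⟨ solve 2 (λ c Z → con 1ℚ :* (con 1ℚ :+ Z :* c) :- c :* Z := con 1ℚ) refl c Z ⟩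
      1ℚ
        ≡⟨ idMat-diag w ⟨
      idMat w w ∎
      where
      open ≡-Reasoning
      column-w : Σ⟨ S′ ⟩ (λ k → A w k * N k w) ≡ (- c) * Z
      column-w = trans
        (Σ⟨⟩-cong S′ (λ {k} k∈ → trans (cong (A w k *_) (schurInverse-iw (delete⇒≢ S k∈)))
                                        (solve 3 (λ a c s → a :* (:- (c :* s)) := (:- c) :* (a :* s)) refl (A w k) c _)))
        (Σ⟨⟩-*ˡ S′ (- c) _)
    schurInverse-row-w {j} (no j≢w) = begin
      Σ⟨ S ⟩ (λ k → A w k * N k j)
        ≡⟨ Σ⟨⟩-split (λ k → A w k * N k j) Sw ⟩
      A w w * N w j + Σ⟨ S′ ⟩ (λ k → A w k * N k j)
        ≡⟨ cong₂ _+_ (cong (A w w *_) (schurInverse-wj j≢w))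
                     (Σ⟨⟩-cong S′ (λ k∈ → cong (A w _ *_) (schurInverse-ij (delete⇒≢ S k∈) j≢w))) ⟩
      A w w * (- (c * X)) + X
        ≡⟨ solve 3 (λ d c X → d :* (:- (c :* X)) :+ X := X :- (c :* d) :* X) refl (A w w) c X ⟩
      X - (c * A w w) * X
        ≡⟨ cong (λ p → X - p * X) pivot ⟩
      X - 1ℚ * X
        ≡⟨ solve 1 (λ X → X :- con 1ℚ :* X := con 0ℚ) refl X ⟩
      0ℚ
        ≡⟨ idMat-≢ (j≢w ∘ sym) ⟨
      idMat w j ∎
      where
      open ≡-Reasoning
      X : ℚ
      X = Σ⟨ S′ ⟩ (λ k → A w k * N′ k j)

    schurInverse-column-w : ∀ {i} → S′ i ≡ true → Σ⟨ S′ ⟩ (λ k → schurComplement A w c i k * N k w) ≡ (- c) * A i w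
    schurInverse-column-w {i} i∈S′ = begin
      Σ⟨ S′ ⟩ (λ k → B i k * N k w)
        ≡⟨ Σ⟨⟩-cong S′ (λ {k} k∈ → trans (cong (B i k *_) (schurInverse-iw (delete⇒≢ S k∈)))
                                         (solve 3 (λ b c s → b :* (:- (c :* s)) := (:- c) :* (b :* s)) refl (B i k) c _)) ⟩
      Σ⟨ S′ ⟩ (λ k → (- c) * (B i k * Σ⟨ S′ ⟩ (λ l → A l w * N′ k l)))
        ≡⟨ Σ⟨⟩-*ˡ S′ (- c) _ ⟩
      (- c) * Σ⟨ S′ ⟩ (λ k → B i k * Σ⟨ S′ ⟩ (λ l → A l w * N′ k l))
        ≡⟨ cong ((- c) *_) (Σ⟨⟩-comm-mul S′ S′ (B i) (λ l → A l w) N′) ⟩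
      (- c) * Σ⟨ S′ ⟩ (λ l → A l w * Σ⟨ S′ ⟩ (λ k → B i k * N′ k l))
        ≡⟨ cong ((- c) *_) (Σ⟨⟩-cong S′ (λ {l} l∈ → cong (A l w *_) (trans (N′-inv i∈S′ l∈) (idMat-sym i l)))) ⟩
      (- c) * Σ⟨ S′ ⟩ (λ l → A l w * idMat l i)
        ≡⟨ cong ((- c) *_) (Σ⟨⟩-idMatʳ S′ (λ l → A l w) i∈S′) ⟩
      (- c) * A i w ∎
      where
      open ≡-Reasoning
      B : Mat n
      B = schurComplement A w c

    schurInverse-row-i : ∀ {i j} → i ≢ w → S i ≡ true → S j ≡ true → Dec (j ≡ w) →
                         Σ⟨ S ⟩ (λ k → A i k * N k j) ≡ idMat i j
    schurInverse-row-i {i} {j} i≢w Si Sj j≟w = begin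
      Σ⟨ S ⟩ (λ k → A i k * N k j)
        ≡⟨ Σ⟨⟩-eliminate {S = S} {A} Sw pivot (λ k → N k j) i ⟩
      Σ⟨ S′ ⟩ (λ k → schurComplement A w c i k * N k j) + A i w * c * Σ⟨ S ⟩ (λ k → A w k * N k j)
        ≡⟨ cong (Σ⟨ S′ ⟩ (λ k → schurComplement A w c i k * N k j) +_) (cong (A i w * c *_) (schurInverse-row-w j≟w)) ⟩
      Σ⟨ S′ ⟩ (λ k → schurComplement A w c i k * N k j) + A i w * c * idMat w j
        ≡⟨ by-column Sj j≟w ⟩
      idMat i j ∎
      where
      open ≡-Reasoning
      i∈S′ : S′ i ≡ true
      i∈S′ = ∈⇒delete S i≢w Si
      by-column : ∀ {j} → S j ≡ true → Dec (j ≡ w) →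
                  Σ⟨ S′ ⟩ (λ k → schurComplement A w c i k * N k j) + A i w * c * idMat w j ≡ idMat i j
      by-column _ (yes refl) = begin
        Σ⟨ S′ ⟩ (λ k → schurComplement A w c i k * N k w) + A i w * c * idMat w w
          ≡⟨ cong₂ _+_ (schurInverse-column-w i∈S′) (cong (A i w * c *_) (idMat-diag w)) ⟩
        (- c) * A i w + A i w * c * 1ℚ
          ≡⟨ solve 2 (λ a c → (:- c) :* a :+ a :* c :* con 1ℚ := con 0ℚ) refl (A i w) c ⟩
        0ℚ
          ≡⟨ idMat-≢ i≢w ⟨
        idMat i w ∎
      by-column {j} Sj (no j≢w) = begin
        Σ⟨ S′ ⟩ (λ k → schurComplement A w c i k * N k j) + A i w * c * idMat w j
          ≡⟨ cong₂ _+_ (Σ⟨⟩-cong S′ (λ k∈ → cong (schurComplement A w c i _ *_) (schurInverse-ij (delete⇒≢ S k∈) j≢w)))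
                       (cong (A i w * c *_) (idMat-≢ (j≢w ∘ sym))) ⟩
        Σ⟨ S′ ⟩ (λ k → schurComplement A w c i k * N′ k j) + A i w * c * 0ℚ
          ≡⟨ cong₂ _+_ (N′-inv i∈S′ (∈⇒delete S j≢w Sj)) (ℚP.*-zeroʳ (A i w * c)) ⟩
        idMat i j + 0ℚ
          ≡⟨ ℚP.+-identityʳ (idMat i j) ⟩
        idMat i j ∎

    schurInverse-left : IsLeftInverseOn S A schurInverse
    schurInverse-left {i} {j} Si Sj with i ≟ w
    ... | yes refl = schurInverse-row-w (j ≟ w)
    ... | no i≢w = schurInverse-row-i i≢w Si Sj (j ≟ w)

module _ (S : Fin n → Bool) (A : Mat n) (w : Fin n) (c : ℚ) (N′ : Mat n) where

  open SchurInverse S A w c N′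
  private
    module T = SchurInverse S (A ᵀ) w c (N′ ᵀ)

  schurInverse-ᵀ : ∀ {i j} → Dec (i ≡ w) → Dec (j ≡ w) → T.schurInverse i j ≡ schurInverse j i
  schurInverse-ᵀ (yes refl) (yes refl) = begin
    T.schurInverse w w ≡⟨ T.schurInverse-ww ⟩
    T.corner           ≡⟨ cong (λ z → c + c * z * c) (Σ⟨⟩-comm-mul S′ S′ (λ k → A k w) (A w) (λ k l → N′ l k)) ⟩
    corner             ≡⟨ schurInverse-ww ⟨
    schurInverse w w   ∎
    where open ≡-Reasoning
  schurInverse-ᵀ (yes refl) (no j≢w) = trans (T.schurInverse-wj j≢w) (sym (schurInverse-iw j≢w))
  schurInverse-ᵀ (no i≢w) (yes refl) = trans (T.schurInverse-iw i≢w) (sym (schurInverse-wj i≢w))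
  schurInverse-ᵀ (no i≢w) (no j≢w) = trans (T.schurInverse-ij i≢w j≢w) (sym (schurInverse-ij j≢w i≢w))

  schurInverse-inverse : S w ≡ true → c * A w w ≡ 1ℚ →
    IsInverseOn S′ (schurComplement A w c) N′ → IsInverseOn S A schurInverse
  schurInverse-inverse Sw pivot (left , right) =
      schurInverse-left Sw pivot left
    , IsLeftInverseOn-cong {A = A ᵀ} {N = T.schurInverse} (λ _ _ → refl) (λ {i} {j} _ _ → schurInverse-ᵀ (i ≟ w) (j ≟ w))
        (T.schurInverse-left Sw pivot (IsLeftInverseOn-cong (λ {i} {j} _ _ → schurComplement-ᵀ i j) (λ _ _ → refl) right))
    where
    schurComplement-ᵀ : ∀ i j → (schurComplement A w c ᵀ) i j ≡ schurComplement (A ᵀ) w c i j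
    schurComplement-ᵀ i j = solve 4 (λ a b c d → a :- b :* c :* d := a :- d :* c :* b) refl (A j i) (A j w) c (A w i)

  schurInverse-nonNeg : (∀ {i j} → S i ≡ true → S j ≡ true → i ≢ j → A i j ≤ 0ℚ) → 0ℚ ≤ c →
    (∀ {i j} → S′ i ≡ true → S′ j ≡ true → 0ℚ ≤ N′ i j) →
    ∀ {i j} → S i ≡ true → S j ≡ true → 0ℚ ≤ schurInverse i j
  schurInverse-nonNeg A≤0 0≤c 0≤N′ {i} {j} Si Sj with i ≟ w | j ≟ w
  ... | yes refl | yes refl = ℚP.+-mono-≤ 0≤c (nonNeg*nonNeg (nonNeg*nonNeg 0≤c 0≤Z) 0≤c)
    where
    0≤Z : 0ℚ ≤ Σ⟨ S′ ⟩ (λ k → A w k * Σ⟨ S′ ⟩ (λ l → A l w * N′ k l))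
    0≤Z = Σ⟨⟩-nonNeg S′ (λ k∈ → nonPos*nonPos (A≤0 Si (delete⇒∈ S k∈) (delete⇒≢ S k∈ ∘ sym))
            (Σ⟨⟩-nonPos S′ (λ l∈ → nonPos*nonNeg (A≤0 (delete⇒∈ S l∈) Si (delete⇒≢ S l∈)) (0≤N′ k∈ l∈))))
  ... | yes refl | no j≢w = ℚP.neg-antimono-≤ (nonNeg*nonPos 0≤c (Σ⟨⟩-nonPos S′ (λ k∈ →
          nonPos*nonNeg (A≤0 Si (delete⇒∈ S k∈) (delete⇒≢ S k∈ ∘ sym)) (0≤N′ k∈ (∈⇒delete S j≢w Sj)))))
  ... | no i≢w | yes refl = ℚP.neg-antimono-≤ (nonNeg*nonPos 0≤c (Σ⟨⟩-nonPos S′ (λ k∈ →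
          nonPos*nonNeg (A≤0 (delete⇒∈ S k∈) Sj (delete⇒≢ S k∈)) (0≤N′ (∈⇒delete S i≢w Si) k∈))))
  ... | no i≢w | no j≢w = 0≤N′ (∈⇒delete S i≢w Si) (∈⇒delete S j≢w Sj)

record IsWeaklyChainedDominant (S : Fin n → Bool) (r : Fin n → ℕ) (A : Mat n) : Set where
  field
    offDiag≤0 : ∀ {i j} → S i ≡ true → S j ≡ true → i ≢ j → A i j ≤ 0ℚ
    rowSum≥0  : ∀ {i} → S i ≡ true → 0ℚ ≤ Σ⟨ S ⟩ (A i)
    chained   : ∀ {i} → S i ≡ true → 0ℚ < Σ⟨ S ⟩ (A i) ⊎ ∃ λ k → S k ≡ true × A i k < 0ℚ × r k ℕ.< r i

module _ {S : Fin n → Bool} {r : Fin n → ℕ} {A : Mat n} (dom : IsWeaklyChainedDominant S r A) where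

  open IsWeaklyChainedDominant dom

  pivot-pos : ∀ {w} → S w ≡ true → 0ℚ < A w w
  pivot-pos {w} Sw = by-chain (chained Sw)
    where
    off≤0 : ∀ {k} → delete w S k ≡ true → A w k ≤ 0ℚ
    off≤0 k∈ = offDiag≤0 Sw (delete⇒∈ S k∈) (delete⇒≢ S k∈ ∘ sym)
    rowSum≡ : Σ⟨ S ⟩ (A w) ≡ A w w + Σ⟨ delete w S ⟩ (A w)
    rowSum≡ = Σ⟨⟩-split (A w) Sw
    by-chain : 0ℚ < Σ⟨ S ⟩ (A w) ⊎ ∃ (λ k → S k ≡ true × A w k < 0ℚ × r k ℕ.< r w) → 0ℚ < A w w
    by-chain (inj₁ 0<rowSum) =
      ℚP.<-≤-trans 0<rowSum (subst (_≤ A w w) (sym rowSum≡) (p+q≤p (Σ⟨⟩-nonPos (delete w S) off≤0)))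
    by-chain (inj₂ (k , Sk , Awk<0 , rk<rw)) =
      ℚP.≤-<-trans (rowSum≥0 Sw) (subst (_< A w w) (sym rowSum≡)
        (p+q<p (ℚP.≤-<-trans (Σ⟨⟩-≤-term (delete w S) {f = A w} off≤0 (∈⇒delete S (rank-≢ r rk<rw) Sk)) Awk<0)))

  module _ {w} (Sw : S w ≡ true) {c} (0<c : 0ℚ < c) (pivot : c * A w w ≡ 1ℚ) where

    private
      S′ : Fin n → Bool
      S′ = delete w S
      B : Mat n
      B = schurComplement A w c
      0≤c : 0ℚ ≤ c
      0≤c = ℚP.<⇒≤ 0<c

      0≤-Aiw : ∀ {i} → S′ i ≡ true → 0ℚ ≤ - A i w
      0≤-Aiw i∈ = ℚP.neg-antimono-≤ (offDiag≤0 (delete⇒∈ S i∈) Sw (delete⇒≢ S i∈))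

      B≡ : ∀ i j → B i j ≡ A i j + (- A i w) * c * A w j
      B≡ i j = solve 4 (λ a b c d → a :- b :* c :* d := a :+ (:- b) :* c :* d) refl (A i j) (A i w) c (A w j)

      B≤A : ∀ {i j} → S′ i ≡ true → S′ j ≡ true → B i j ≤ A i j
      B≤A {i} {j} i∈ j∈ = subst (_≤ A i j) (sym (B≡ i j))
        (p+q≤p (nonNeg*nonPos (nonNeg*nonNeg (0≤-Aiw i∈) 0≤c) (offDiag≤0 Sw (delete⇒∈ S j∈) (delete⇒≢ S j∈ ∘ sym))))

      rowSum-schur : ∀ i → Σ⟨ S′ ⟩ (B i) ≡ Σ⟨ S ⟩ (A i) + (- A i w) * c * Σ⟨ S ⟩ (A w)
      rowSum-schur i = begin
        Σ⟨ S′ ⟩ (B i)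
          ≡⟨ solve 4 (λ x a c y → x := (x :+ a :* c :* y) :+ (:- a) :* c :* y) refl (Σ⟨ S′ ⟩ (B i)) (A i w) c (Σ⟨ S ⟩ (A w)) ⟩
        (Σ⟨ S′ ⟩ (B i) + A i w * c * Σ⟨ S ⟩ (A w)) + (- A i w) * c * Σ⟨ S ⟩ (A w)
          ≡⟨ cong (_+ (- A i w) * c * Σ⟨ S ⟩ (A w)) eliminated ⟨
        Σ⟨ S ⟩ (A i) + (- A i w) * c * Σ⟨ S ⟩ (A w) ∎
        where
        open ≡-Reasoning
        ·1 : ∀ (T : Fin n → Bool) (f : Fin n → ℚ) → Σ⟨ T ⟩ (λ k → f k * 1ℚ) ≡ Σ⟨ T ⟩ f
        ·1 T f = Σ⟨⟩-cong T (λ {k} _ → ℚP.*-identityʳ (f k))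
        eliminated : Σ⟨ S ⟩ (A i) ≡ Σ⟨ S′ ⟩ (B i) + A i w * c * Σ⟨ S ⟩ (A w)
        eliminated = trans (sym (·1 S (A i))) (trans (Σ⟨⟩-eliminate {S = S} {A} Sw pivot (λ _ → 1ℚ) i)
                                                    (cong₂ (λ x y → x + A i w * c * y) (·1 S′ (B i)) (·1 S (A w))))

      rowSum≤ : ∀ {i} → S′ i ≡ true → Σ⟨ S ⟩ (A i) ≤ Σ⟨ S′ ⟩ (B i)
      rowSum≤ {i} i∈ = subst (Σ⟨ S ⟩ (A i) ≤_) (sym (rowSum-schur i))
        (p≤p+q (nonNeg*nonNeg (nonNeg*nonNeg (0≤-Aiw i∈) 0≤c) (rowSum≥0 Sw)))

      chained′ : ∀ {i} → S′ i ≡ true → 0ℚ < Σ⟨ S′ ⟩ (B i) ⊎ ∃ λ k → S′ k ≡ true × B i k < 0ℚ × r k ℕ.< r i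
      chained′ {i} i∈ with chained (delete⇒∈ S i∈)
      ... | inj₁ 0<rowSum = inj₁ (ℚP.<-≤-trans 0<rowSum (rowSum≤ i∈))
      ... | inj₂ (k , Sk , Aik<0 , rk<ri) with k ≟ w
      ...   | no k≢w = inj₂ (k , ∈⇒delete S k≢w Sk , ℚP.≤-<-trans (B≤A i∈ (∈⇒delete S k≢w Sk)) Aik<0 , rk<ri)
      ...   | yes refl = via-pivot (chained Sw)
        where
        0<-Aiw : 0ℚ < - A i w
        0<-Aiw = ℚP.neg-antimono-< Aik<0
        via-pivot : 0ℚ < Σ⟨ S ⟩ (A w) ⊎ ∃ (λ k → S k ≡ true × A w k < 0ℚ × r k ℕ.< r w) →
                    0ℚ < Σ⟨ S′ ⟩ (B i) ⊎ ∃ λ k → S′ k ≡ true × B i k < 0ℚ × r k ℕ.< r i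
        via-pivot (inj₁ 0<rowSum-w) = inj₁ (subst (0ℚ <_) (sym (rowSum-schur i))
          (ℚP.<-≤-trans (pos*pos (pos*pos 0<-Aiw 0<c) 0<rowSum-w) (p≤q+p (rowSum≥0 (delete⇒∈ S i∈)))))
        via-pivot (inj₂ (k , Sk , Awk<0 , rk<rw)) =
          inj₂ (k , ∈⇒delete S (rank-≢ r rk<rw) Sk , Bik<0 , ℕP.<-trans rk<rw rk<ri)
          where
          Bik<0 : B i k < 0ℚ
          Bik<0 = subst (_< 0ℚ) (sym (B≡ i k)) (ℚP.<-≤-trans (p+q<p (pos*neg (pos*pos 0<-Aiw 0<c) Awk<0))
            (offDiag≤0 (delete⇒∈ S i∈) Sk (rank-≢ r (ℕP.<-trans rk<rw rk<ri) ∘ sym)))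

    schurComplement-dominant : IsWeaklyChainedDominant S′ r B
    schurComplement-dominant = record
      { offDiag≤0 = λ i∈ j∈ i≢j → ℚP.≤-trans (B≤A i∈ j∈) (offDiag≤0 (delete⇒∈ S i∈) (delete⇒∈ S j∈) i≢j)
      ; rowSum≥0  = λ i∈ → ℚP.≤-trans (rowSum≥0 (delete⇒∈ S i∈)) (rowSum≤ i∈)
      ; chained   = chained′
      }

NonNegInverseOn : (Fin n → Bool) → Mat n → Set
NonNegInverseOn S A = ∃ λ N → IsInverseOn S A N × (∀ {i j} → S i ≡ true → S j ≡ true → 0ℚ ≤ N i j)

dominant⇒nonNegInverse : ∀ (L : List (Fin n)) {S : Fin n → Bool} {r A} → (∀ {i} → S i ≡ true → i ∈ₗ L) →
                         IsWeaklyChainedDominant S r A → NonNegInverseOn S A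
dominant⇒nonNegInverse [] {S} S⊆[] _ = (λ _ _ → 0ℚ) , (∉[] , ∉[]) , ∉[]
  where
  ∉[] : ∀ {a} {B : Set a} {i} → S i ≡ true → B
  ∉[] Si with S⊆[] Si
  ... | ()
dominant⇒nonNegInverse (w ∷ L) {S} S⊆w∷L dom with S w in Sw
... | false = dominant⇒nonNegInverse L S⊆L dom
  where
  S⊆L : ∀ {i} → S i ≡ true → i ∈ₗ L
  S⊆L Si with S⊆w∷L Si
  ... | there i∈L = i∈L
  ... | here refl with trans (sym Si) Sw
  ...   | ()
dominant⇒nonNegInverse (w ∷ L) {S} {r} {A} S⊆w∷L dom | true =
  extend (dominant⇒nonNegInverse L S′⊆L (schurComplement-dominant dom Sw 0<c pivot))
  where
  0<Aww : 0ℚ < A w w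
  0<Aww = pivot-pos dom Sw
  instance
    Aww≢0 : ℚ.NonZero (A w w)
    Aww≢0 = ℚP.pos⇒nonZero (A w w) {{ℚ.positive 0<Aww}}
  c : ℚ
  c = ℚ.1/ (A w w)
  0<c : 0ℚ < c
  0<c = ℚP.positive⁻¹ c {{ℚP.1/pos⇒pos (A w w) {{ℚ.positive 0<Aww}}}}
  pivot : c * A w w ≡ 1ℚ
  pivot = ℚP.*-inverseˡ (A w w)
  S′⊆L : ∀ {i} → delete w S i ≡ true → i ∈ₗ L
  S′⊆L i∈ with S⊆w∷L (delete⇒∈ S i∈)
  ... | there i∈L = i∈L
  ... | here i≡w = ⊥-elim (delete⇒≢ S i∈ i≡w)
  extend : NonNegInverseOn (delete w S) (schurComplement A w c) → NonNegInverseOn S A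
  extend (N′ , inverse′ , 0≤N′) =
      SchurInverse.schurInverse S A w c N′
    , schurInverse-inverse S A w c N′ Sw pivot inverse′
    , schurInverse-nonNeg S A w c N′ (IsWeaklyChainedDominant.offDiag≤0 dom) (ℚP.<⇒≤ 0<c) 0≤N′

module _ {P : Mat n} (0≤P : ∀ i j → 0ℚ ≤ P i j) where

  matPow-nonNeg : ∀ ℓ i j → 0ℚ ≤ matPow P ℓ i j
  matPow-nonNeg ℕ.zero = idMat-nonNeg
  matPow-nonNeg (ℕ.suc ℓ) i j = Σ⟨⟩-nonNeg full (λ {k} _ → nonNeg*nonNeg (matPow-nonNeg ℓ i k) (0≤P k j))

matPow-sucˡ : ∀ (P : Mat n) ℓ i j → matPow P (ℕ.suc ℓ) i j ≡ sum (λ k → P i k * matPow P ℓ k j)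
matPow-sucˡ P ℕ.zero i j = trans (Σ⟨⟩-idMatˡ full (λ k → P k j) refl) (sym (Σ⟨⟩-idMatʳ full (P i) refl))
matPow-sucˡ P (ℕ.suc ℓ) i j = begin
  sum (λ k → matPow P (ℕ.suc ℓ) i k * P k j)
    ≡⟨ Σ⟨⟩-cong full (λ {k} _ → trans (cong (_* P k j) (matPow-sucˡ P ℓ i k)) (ℚP.*-comm _ (P k j))) ⟩
  sum (λ k → P k j * sum (λ l → P i l * matPow P ℓ l k))
    ≡⟨ Σ⟨⟩-comm-mul full full (λ l → P i l) (λ k → P k j) (matPow P ℓ) ⟨
  sum (λ l → P i l * sum (λ k → P k j * matPow P ℓ l k))
    ≡⟨ Σ⟨⟩-cong full (λ {l} _ → cong (P i l *_) (Σ⟨⟩-cong full (λ {k} _ → ℚP.*-comm (P k j) (matPow P ℓ l k)))) ⟩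
  sum (λ l → P i l * matPow P (ℕ.suc ℓ) l j) ∎
  where open ≡-Reasoning

probOutside-Σ⟨⟩ : ∀ (P : Mat n) W ℓ v → probOutside P W ℓ v ≡ Σ⟨ not ∘ lookup W ⟩ (matPow P ℓ v)
probOutside-Σ⟨⟩ P W ℓ v = sum-cong-≗ pointwise
  where
  pointwise : ∀ u → (if lookup W u then 0ℚ else matPow P ℓ v u) ≡ mask (not ∘ lookup W) (matPow P ℓ v) u
  pointwise u with lookup W u
  ... | true = refl
  ... | false = refl

EscapeStep : Mat n → (Fin n → Bool) → (Fin n → ℕ) → Fin n → Set
EscapeStep P S r v = (∃ λ u → S u ≡ false × 0ℚ < P v u) ⊎ (∃ λ k → S k ≡ true × 0ℚ < P v k × r k ℕ.< r v)

IsEscapeRank : Mat n → (Fin n → Bool) → (Fin n → ℕ) → Set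
IsEscapeRank P S r = ∀ {v} → S v ≡ true → EscapeStep P S r v

module _ {P : Mat n} (0≤P : ∀ i j → 0ℚ ≤ P i j) {W : Subset n} where

  private
    S : Fin n → Bool
    S = lookup W

  outside-witness : ∀ {ℓ v} → 0ℚ < probOutside P W ℓ v → ∃ λ u → S u ≡ false × 0ℚ < matPow P ℓ v u
  outside-witness {ℓ} {v} 0<prob with Σ⟨⟩-pos⇒∃ (not ∘ S) (matPow P ℓ v) (subst (0ℚ <_) (probOutside-Σ⟨⟩ P W ℓ v) 0<prob)
  ... | u , u∉W , 0<Pℓvu = u , not-injective u∉W , 0<Pℓvu

  module _ (escapes : ∀ v → v ∈ W → Σ ℕ λ ℓ → 0ℚ < probOutside P W ℓ v) where

    private
      first-escape : ∀ v → v ∈ W → ∃ λ ℓ → 0ℚ < probOutside P W ℓ v × (∀ {k} → 0ℚ < probOutside P W k v → ℓ ℕ.≤ k)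
      first-escape v v∈W = least-witness {Q = λ ℓ → 0ℚ < probOutside P W ℓ v} (λ ℓ → 0ℚ ℚP.<? probOutside P W ℓ v)
                                         {L = proj₁ (escapes v v∈W)} (proj₂ (escapes v v∈W))

    -- The least ℓ with P(X_ℓ ∉ W | X₀ = v) > 0; the value 0 outside W is never used.
    escapeRank : Fin n → ℕ
    escapeRank v with v ∈? W
    ... | yes v∈W = proj₁ (first-escape v v∈W)
    ... | no _ = 0

    escapeRank-escapes : ∀ {v} → S v ≡ true → 0ℚ < probOutside P W (escapeRank v) v
    escapeRank-escapes {v} Sv with v ∈? W
    ... | yes v∈W = proj₁ (proj₂ (first-escape v v∈W))
    ... | no v∉W = ⊥-elim (v∉W (lookup⇒[]= v W Sv))

    escapeRank-least : ∀ {ℓ v} → 0ℚ < probOutside P W ℓ v → escapeRank v ℕ.≤ ℓ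
    escapeRank-least {v = v} 0<prob with v ∈? W
    ... | yes v∈W = proj₂ (proj₂ (first-escape v v∈W)) 0<prob
    ... | no _ = ℕ.z≤n

    complement-nonempty : ∀ {v} → S v ≡ true → ∃ λ u → S u ≡ false
    complement-nonempty {v} Sv with outside-witness {ℓ = escapeRank v} (escapeRank-escapes Sv)
    ... | u , Su , _ = u , Su

    escapeRank-isEscapeRank : IsEscapeRank P S escapeRank
    escapeRank-isEscapeRank {v} Sv with outside-witness {ℓ = escapeRank v} (escapeRank-escapes Sv)
    ... | u , Su , 0<Pℓvu = first-step (escapeRank v) 0<Pℓvu
      where
      first-step : ∀ ℓ → 0ℚ < matPow P ℓ v u →
        (∃ λ u → S u ≡ false × 0ℚ < P v u) ⊎ (∃ λ k → S k ≡ true × 0ℚ < P v k × escapeRank k ℕ.< ℓ)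
      first-step ℕ.zero 0<idMat with v ≟ u
      ... | yes refl with trans (sym Sv) Su
      ...   | ()
      first-step ℕ.zero 0<idMat | no _ = ⊥-elim (ℚP.<-irrefl refl 0<idMat)
      first-step (ℕ.suc ℓ) 0<Pℓ⁺¹vu
        with Σ⟨⟩-pos⇒∃ full (λ k → P v k * matPow P ℓ k u) (subst (0ℚ <_) (matPow-sucˡ P ℓ v u) 0<Pℓ⁺¹vu)
      ... | k , _ , 0<PvkPℓku with pos-factors (0≤P v k) (matPow-nonNeg 0≤P ℓ k u) 0<PvkPℓku | S k in Sk
      ...   | 0<Pvk , _ | false = inj₁ (k , Sk , 0<Pvk)
      ...   | 0<Pvk , 0<Pℓku | true = inj₂ (k , Sk , 0<Pvk , ℕ.s≤s (escapeRank-least 0<prob))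
        where
        0<prob : 0ℚ < probOutside P W ℓ k
        0<prob = subst (0ℚ <_) (sym (probOutside-Σ⟨⟩ P W ℓ k))
          (ℚP.<-≤-trans 0<Pℓku (Σ⟨⟩-≥-term (not ∘ S) {f = matPow P ℓ k} (λ _ → matPow-nonNeg 0≤P ℓ k _) (cong not Su)))

exitProbability : Mat n → (Fin n → Bool) → Fin n → ℚ
exitProbability P S i = Σ⟨ not ∘ S ⟩ (P i)

module _ {P : Mat n} (stochastic : IsStochastic P) {S : Fin n → Bool} where

  private
    0≤P : ∀ i j → 0ℚ ≤ P i j
    0≤P = proj₁ stochastic

  rowSum+exitProbability : ∀ i → Σ⟨ S ⟩ (P i) + exitProbability P S i ≡ 1ℚ
  rowSum+exitProbability i = trans (sym (Σ⟨⟩-complement S (P i))) (proj₂ stochastic i)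

  exitProbability-nonNeg : ∀ i → 0ℚ ≤ exitProbability P S i
  exitProbability-nonNeg i = Σ⟨⟩-nonNeg (not ∘ S) (λ _ → 0≤P i _)

  step-out≤exitProbability : ∀ {i u} → S u ≡ false → P i u ≤ exitProbability P S i
  step-out≤exitProbability {i} Su = Σ⟨⟩-≥-term (not ∘ S) {f = P i} (λ _ → 0≤P i _) (cong not Su)

  rowSum-IminusP : ∀ {i} → S i ≡ true → Σ⟨ S ⟩ (IminusP P i) ≡ exitProbability P S i
  rowSum-IminusP {i} Si = begin
    Σ⟨ S ⟩ (λ k → idMat i k - P i k)
      ≡⟨ Σ⟨⟩-cong S (λ {k} _ → cong (λ x → idMat i k - x) (sym (ℚP.*-identityˡ (P i k)))) ⟩
    Σ⟨ S ⟩ (λ k → idMat i k - 1ℚ * P i k)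
      ≡⟨ Σ⟨⟩-sub-* S 1ℚ (idMat i) (P i) ⟩
    Σ⟨ S ⟩ (idMat i) - 1ℚ * Σ⟨ S ⟩ (P i)
      ≡⟨ cong (λ x → x - 1ℚ * Σ⟨ S ⟩ (P i)) (trans (Σ⟨⟩-single S Si (λ _ k≢i → idMat-≢ (k≢i ∘ sym))) (idMat-diag i)) ⟩
    1ℚ - 1ℚ * Σ⟨ S ⟩ (P i)
      ≡⟨ cong (λ x → x - 1ℚ * Σ⟨ S ⟩ (P i)) (rowSum+exitProbability i) ⟨
    (Σ⟨ S ⟩ (P i) + e) - 1ℚ * Σ⟨ S ⟩ (P i)
      ≡⟨ solve 2 (λ x e → (x :+ e) :- con 1ℚ :* x := e) refl (Σ⟨ S ⟩ (P i)) e ⟩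
    e ∎
    where
    open ≡-Reasoning
    e : ℚ
    e = exitProbability P S i

  IminusP-dominant : ∀ {r} → IsEscapeRank P S r → IsWeaklyChainedDominant S r (IminusP P)
  IminusP-dominant {r} escape = record
    { offDiag≤0 = λ {i} {j} _ _ i≢j → subst (_≤ 0ℚ) (sym (off-diagonal i≢j)) (ℚP.neg-antimono-≤ (0≤P i j))
    ; rowSum≥0  = λ Si → subst (0ℚ ≤_) (sym (rowSum-IminusP Si)) (exitProbability-nonNeg _)
    ; chained   = λ Si → chained Si (escape Si)
    }
    where
    off-diagonal : ∀ {i j} → i ≢ j → IminusP P i j ≡ - P i j
    off-diagonal {i} {j} i≢j = trans (cong (_- P i j) (idMat-≢ i≢j)) (ℚP.+-identityˡ (- P i j))
    chained : ∀ {i} → S i ≡ true → EscapeStep P S r i →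
              0ℚ < Σ⟨ S ⟩ (IminusP P i) ⊎ ∃ λ k → S k ≡ true × IminusP P i k < 0ℚ × r k ℕ.< r i
    chained Si (inj₁ (u , Su , 0<Piu)) =
      inj₁ (subst (0ℚ <_) (sym (rowSum-IminusP Si)) (ℚP.<-≤-trans 0<Piu (step-out≤exitProbability Su)))
    chained Si (inj₂ (k , Sk , 0<Pik , rk<ri)) =
      inj₂ (k , Sk , subst (_< 0ℚ) (sym (off-diagonal (rank-≢ r rk<ri ∘ sym))) (ℚP.neg-antimono-< 0<Pik) , rk<ri)

module _ {P : Mat n} (stochastic : IsStochastic P) {S : Fin n → Bool} {r : Fin n → ℕ} (escape : IsEscapeRank P S r)
         {N : Mat n} (N-inv : IsLeftInverseOn S (IminusP P) N) (0≤N : ∀ {i j} → S i ≡ true → S j ≡ true → 0ℚ ≤ N i j)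
         {M : Fin n → ℕ} (1≤M : ∀ i → 1 ℕ.≤ M i) (M-clears : ∀ {i k} → 0ℚ < P i k → 1ℚ ≤ ℕ→ℚ (M i) * P i k) where

  private
    0≤P : ∀ i j → 0ℚ ≤ P i j
    0≤P = proj₁ stochastic

    exit : Fin n → ℚ
    exit = exitProbability P S

    below : Fin n → Fin n → Bool
    below i x = S x ∧ ⌊ r x ℕ.≤? r i ⌋

    below⇒S : ∀ {i x} → below i x ≡ true → S x ≡ true
    below⇒S {x = x} x∈ with S x
    ... | true = refl

    below-self : ∀ {i} → S i ≡ true → below i i ≡ true
    below-self {i} Si rewrite Si with r i ℕ.≤? r i
    ... | yes _ = refl
    ... | no ri≰ri = ⊥-elim (ri≰ri ℕP.≤-refl)

    below-mono : ∀ {k i} → r k ℕ.< r i → ∀ {x} → below k x ≡ true → below i x ≡ true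
    below-mono {k} {i} rk<ri {x} x∈ with S x | r x ℕ.≤? r k | r x ℕ.≤? r i
    ... | true | yes _     | yes _ = refl
    ... | true | yes rx≤rk | no rx≰ri = ⊥-elim (rx≰ri (ℕP.≤-trans rx≤rk (ℕP.<⇒≤ rk<ri)))

    above-excluded : ∀ {k i} → r k ℕ.< r i → below k i ≡ false
    above-excluded {k} {i} rk<ri with S i | r i ℕ.≤? r k
    ... | false | _ = refl
    ... | true | no _ = refl
    ... | true | yes ri≤rk = ⊥-elim (ℕP.<-irrefl refl (ℕP.<-≤-trans rk<ri ri≤rk))

  module _ {j} (Sj : S j ≡ true) where

    private
      h : Fin n → ℚ
      h k = N k j

      h-eq : ∀ {i} → S i ≡ true → h i ≡ idMat i j + Σ⟨ S ⟩ (λ k → P i k * h k)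
      h-eq {i} Si = begin
        h i                                                    ≡⟨ solve 2 (λ h X → h := (h :- con 1ℚ :* X) :+ X) refl (h i) X ⟩
        (h i - 1ℚ * X) + X                                     ≡⟨ cong (λ y → (y - 1ℚ * X) + X) (Σ⟨⟩-idMatˡ S h Si) ⟨
        (Σ⟨ S ⟩ (λ k → idMat i k * h k) - 1ℚ * X) + X          ≡⟨ cong (_+ X) (Σ⟨⟩-sub-* S 1ℚ _ _) ⟨
        Σ⟨ S ⟩ (λ k → idMat i k * h k - 1ℚ * (P i k * h k)) + X ≡⟨ cong (_+ X) (Σ⟨⟩-cong S (λ {k} _ → factor-out (idMat i k) (P i k) (h k))) ⟩
        Σ⟨ S ⟩ (λ k → IminusP P i k * N k j) + X               ≡⟨ cong (_+ X) (N-inv Si Sj) ⟩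
        idMat i j + X                                          ∎
        where
        open ≡-Reasoning
        X : ℚ
        X = Σ⟨ S ⟩ (λ k → P i k * h k)
        factor-out : ∀ d p x → d * x - 1ℚ * (p * x) ≡ (d - p) * x
        factor-out = solve 3 (λ d p x → d :* x :- con 1ℚ :* (p :* x) := (d :- p) :* x) refl

      maximum : ∃ λ i → S i ≡ true × (∀ {k} → S k ≡ true → h k ≤ h i)
      maximum = argmax-on S h Sj

      m : ℚ
      m = h (proj₁ maximum)

      h≤m : ∀ {k} → S k ≡ true → h k ≤ m
      h≤m = proj₂ (proj₂ maximum)

      u : Fin n → ℚ
      u k = m - h k

      0≤u : ∀ {k} → S k ≡ true → 0ℚ ≤ u k
      0≤u {k} Sk = subst (_≤ u k) (ℚP.+-inverseʳ (h k)) (ℚP.+-monoˡ-≤ (- h k) (h≤m Sk))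

      0<m : 0ℚ < m
      0<m = ℚP.<-≤-trans (ℚP.positive⁻¹ 1ℚ) (ℚP.≤-trans 1≤h[j] (h≤m Sj))
        where
        1≤h[j] : 1ℚ ≤ h j
        1≤h[j] = subst₂ _≤_ (idMat-diag j) (sym (h-eq Sj))
          (p≤p+q (Σ⟨⟩-nonNeg S (λ Sk → nonNeg*nonNeg (0≤P j _) (0≤N Sk Sj))))

      u-eq : ∀ {i} → S i ≡ true → u i + idMat i j ≡ Σ⟨ S ⟩ (λ k → P i k * u k) + exit i * m
      u-eq {i} Si = begin
        (m - h i) + idMat i j
          ≡⟨ cong (λ y → (m - y) + idMat i j) (h-eq Si) ⟩
        (m - (idMat i j + X)) + idMat i j
          ≡⟨ solve 3 (λ m d X → (m :- (d :+ X)) :+ d := m :* con 1ℚ :- X) refl m (idMat i j) X ⟩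
        m * 1ℚ - X
          ≡⟨ cong (λ y → m * y - X) (rowSum+exitProbability stochastic i) ⟨
        m * (Σ⟨ S ⟩ (P i) + exit i) - X
          ≡⟨ solve 4 (λ m s e X → m :* (s :+ e) :- X := (m :* s :- con 1ℚ :* X) :+ e :* m) refl m (Σ⟨ S ⟩ (P i)) (exit i) X ⟩
        (m * Σ⟨ S ⟩ (P i) - 1ℚ * X) + exit i * m
          ≡⟨ cong (_+ exit i * m) Pu≡ ⟨
        Σ⟨ S ⟩ (λ k → P i k * u k) + exit i * m ∎
        where
        open ≡-Reasoning
        X : ℚ
        X = Σ⟨ S ⟩ (λ k → P i k * h k)
        Pu≡ : Σ⟨ S ⟩ (λ k → P i k * u k) ≡ m * Σ⟨ S ⟩ (P i) - 1ℚ * X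
        Pu≡ = begin
          Σ⟨ S ⟩ (λ k → P i k * u k)
            ≡⟨ Σ⟨⟩-cong S (λ {k} _ → solve 3 (λ p m h → p :* (m :- h) := m :* p :- con 1ℚ :* (p :* h)) refl (P i k) m (h k)) ⟩
          Σ⟨ S ⟩ (λ k → m * P i k - 1ℚ * (P i k * h k))
            ≡⟨ Σ⟨⟩-sub-* S 1ℚ _ _ ⟩
          Σ⟨ S ⟩ (λ k → m * P i k) - 1ℚ * X
            ≡⟨ cong (_- 1ℚ * X) (Σ⟨⟩-*ˡ S m (P i)) ⟩
          m * Σ⟨ S ⟩ (P i) - 1ℚ * X ∎

      0≤Pu : ∀ i → 0ℚ ≤ Σ⟨ S ⟩ (λ k → P i k * u k)
      0≤Pu i = Σ⟨⟩-nonNeg S (λ Sk → nonNeg*nonNeg (0≤P i _) (0≤u Sk))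

      exit-bound : ∀ {i} → S i ≡ true → exit i * m ≤ u i + idMat i j
      exit-bound {i} Si = subst (exit i * m ≤_) (sym (u-eq Si)) (p≤q+p (0≤Pu i))

      step-bound : ∀ {i k} → S i ≡ true → S k ≡ true → P i k * u k ≤ u i + idMat i j
      step-bound {i} {k} Si Sk = subst (P i k * u k ≤_) (sym (u-eq Si)) (ℚP.≤-trans
        (Σ⟨⟩-≥-term S {f = λ k → P i k * u k} (λ Sl → nonNeg*nonNeg (0≤P i _) (0≤u Sl)) Sk)
        (p≤p+q (nonNeg*nonNeg (exitProbability-nonNeg stochastic i) (ℚP.<⇒≤ 0<m))))

      -- Maximum principle: a zero of u propagates along escape steps until it reaches j.
      u[j]≡0 : u j ≡ 0ℚ
      u[j]≡0 = rank-induction r Q step (proj₁ maximum) (proj₁ (proj₂ maximum)) (ℚP.+-inverseʳ m)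
        where
        Q : Fin n → Set
        Q i = S i ≡ true → u i ≡ 0ℚ → u j ≡ 0ℚ
        step : ∀ i → (∀ {k} → r k ℕ.< r i → Q k) → Q i
        step i IH Si ui≡0 with i ≟ j
        ... | yes refl = ui≡0
        ... | no i≢j = follow (escape Si)
          where
          slack≡0 : u i + idMat i j ≡ 0ℚ
          slack≡0 = trans (cong₂ _+_ ui≡0 (idMat-≢ i≢j)) (ℚP.+-identityˡ 0ℚ)
          follow : EscapeStep P S r i → u j ≡ 0ℚ
          follow (inj₁ (v , Sv , 0<Piv)) = ⊥-elim (ℚP.<-irrefl refl
            (ℚP.<-≤-trans (pos*pos (ℚP.<-≤-trans 0<Piv (step-out≤exitProbability stochastic Sv)) 0<m)
                          (subst (exit i * m ≤_) slack≡0 (exit-bound Si))))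
          follow (inj₂ (k , Sk , 0<Pik , rk<ri)) = IH rk<ri Sk (ℚP.≤-antisym (ℚP.≮⇒≥ 0≮uk) (0≤u Sk))
            where
            0≮uk : ¬ 0ℚ < u k
            0≮uk 0<uk = ℚP.<-irrefl refl (ℚP.<-≤-trans (pos*pos 0<Pik 0<uk) (subst (P i k * u k ≤_) slack≡0 (step-bound Si Sk)))

      0≤slack : ∀ {i} → S i ≡ true → 0ℚ ≤ u i + idMat i j
      0≤slack {i} Si = ℚP.+-mono-≤ (0≤u Si) (idMat-nonNeg i j)

      1≤M·exit : ∀ {i v} → S v ≡ false → 0ℚ < P i v → 1ℚ ≤ ℕ→ℚ (M i) * exit i
      1≤M·exit {i} Sv 0<Piv = ℚP.≤-trans (M-clears 0<Piv) (*-monoˡ-≤ (ℕ→ℚ-nonNeg (M i)) (step-out≤exitProbability stochastic Sv))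

      u≤M·slack : ∀ {i k} → S i ≡ true → S k ≡ true → 0ℚ < P i k → u k ≤ ℕ→ℚ (M i) * (u i + idMat i j)
      u≤M·slack {i} {k} Si Sk 0<Pik = begin
        u k                             ≤⟨ x≤a*x (M-clears 0<Pik) (0≤u Sk) ⟩
        ℕ→ℚ (M i) * P i k * u k         ≡⟨ ℚP.*-assoc (ℕ→ℚ (M i)) (P i k) (u k) ⟩
        ℕ→ℚ (M i) * (P i k * u k)       ≤⟨ *-monoˡ-≤ (ℕ→ℚ-nonNeg (M i)) (step-bound Si Sk) ⟩
        ℕ→ℚ (M i) * (u i + idMat i j)   ∎
        where open ℚP.≤-Reasoning

      chain-bound : ∀ i → S i ≡ true → r i ℕ.≤ r j → m ≤ ℕ→ℚ (Π⟨ below i ⟩ M) * (u i + idMat i j)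
      chain-bound = rank-induction r Q step
        where
        Q : Fin n → Set
        Q i = S i ≡ true → r i ℕ.≤ r j → m ≤ ℕ→ℚ (Π⟨ below i ⟩ M) * (u i + idMat i j)
        step : ∀ i → (∀ {k} → r k ℕ.< r i → Q k) → Q i
        step i IH Si ri≤rj = follow (escape Si)
          where
          open ℚP.≤-Reasoning
          follow : EscapeStep P S r i → m ≤ ℕ→ℚ (Π⟨ below i ⟩ M) * (u i + idMat i j)
          follow (inj₁ (v , Sv , 0<Piv)) = begin
            m                                         ≤⟨ x≤a*x (1≤M·exit Sv 0<Piv) (ℚP.<⇒≤ 0<m) ⟩
            ℕ→ℚ (M i) * exit i * m                    ≡⟨ ℚP.*-assoc (ℕ→ℚ (M i)) (exit i) m ⟩
            ℕ→ℚ (M i) * (exit i * m)                  ≤⟨ *-monoˡ-≤ (ℕ→ℚ-nonNeg (M i)) (exit-bound Si) ⟩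
            ℕ→ℚ (M i) * (u i + idMat i j)             ≤⟨ *-monoʳ-≤ (0≤slack Si) (ℕ→ℚ-mono-≤ (Π⟨⟩-≥-factor 1≤M (below-self Si))) ⟩
            ℕ→ℚ (Π⟨ below i ⟩ M) * (u i + idMat i j) ∎
          follow (inj₂ (k , Sk , 0<Pik , rk<ri)) = begin
            m                                          ≤⟨ IH rk<ri Sk (ℕP.<⇒≤ (ℕP.<-≤-trans rk<ri ri≤rj)) ⟩
            ℕ→ℚ Πk * (u k + idMat k j)                  ≡⟨ cong (λ d → ℕ→ℚ Πk * (u k + d)) (idMat-≢ (rank-≢ r (ℕP.<-≤-trans rk<ri ri≤rj))) ⟩
            ℕ→ℚ Πk * (u k + 0ℚ)                         ≡⟨ cong (ℕ→ℚ Πk *_) (ℚP.+-identityʳ (u k)) ⟩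
            ℕ→ℚ Πk * u k                                ≤⟨ *-monoˡ-≤ (ℕ→ℚ-nonNeg Πk) (u≤M·slack Si Sk 0<Pik) ⟩
            ℕ→ℚ Πk * (ℕ→ℚ (M i) * (u i + idMat i j))    ≡⟨ solve 3 (λ a b c → a :* (b :* c) := (b :* a) :* c) refl (ℕ→ℚ Πk) (ℕ→ℚ (M i)) _ ⟩
            (ℕ→ℚ (M i) * ℕ→ℚ Πk) * (u i + idMat i j)    ≡⟨ cong (_* (u i + idMat i j)) (ℕ→ℚ-homo-* (M i) Πk) ⟨
            ℕ→ℚ (M i ℕ.* Πk) * (u i + idMat i j)        ≤⟨ *-monoʳ-≤ (0≤slack Si) (ℕ→ℚ-mono-≤
                                                             (Π⟨⟩-insert 1≤M (above-excluded rk<ri) (below-self Si) (below-mono rk<ri))) ⟩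
            ℕ→ℚ (Π⟨ below i ⟩ M) * (u i + idMat i j)    ∎
            where
            Πk : ℕ
            Πk = Π⟨ below k ⟩ M

    inverse-column-bounded : ∀ {i} → S i ≡ true → N i j ≤ ℕ→ℚ (Π⟨ S ⟩ M)
    inverse-column-bounded {i} Si = begin
      h i                                        ≤⟨ ℚP.≤-trans (h≤m Si) (chain-bound j Sj ℕP.≤-refl) ⟩
      ℕ→ℚ (Π⟨ below j ⟩ M) * (u j + idMat j j)   ≡⟨ cong₂ (λ a b → ℕ→ℚ (Π⟨ below j ⟩ M) * (a + b)) u[j]≡0 (idMat-diag j) ⟩
      ℕ→ℚ (Π⟨ below j ⟩ M) * 1ℚ                  ≡⟨ ℚP.*-identityʳ _ ⟩
      ℕ→ℚ (Π⟨ below j ⟩ M)                      ≤⟨ ℕ→ℚ-mono-≤ (Π⟨⟩-mono-⊆ 1≤M below⇒S) ⟩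
      ℕ→ℚ (Π⟨ S ⟩ M)                             ∎
      where open ℚP.≤-Reasoning

IsInverseOn⇒IsInverseW : ∀ {W : Subset n} {A N : Mat n} → IsInverseOn (lookup W) A N → IsInverseW W A N
IsInverseOn⇒IsInverseW {W = W} {A} {N} (left , right) =
    (λ i j i∈W j∈W → left ([]=⇒lookup i∈W) ([]=⇒lookup j∈W))
  , (λ i j i∈W j∈W → trans (Σ⟨⟩-cong (lookup W) (λ {k} _ → ℚP.*-comm (N i k) (A k j)))
                           (trans (right ([]=⇒lookup j∈W) ([]=⇒lookup i∈W)) (idMat-sym j i)))

lemma3p6 : (n : ℕ) (P : Mat n) → IsStochastic P →
    (W : Subset n) → IsOpen P W →
    Σ (Mat n) (λ N → IsInverseW W (IminusP P) N
    × (∀ i j → i ∈ W → j ∈ W → ∣ N i j ∣ ≤ ℕ→ℚ (Πℕ[ W ] (rowLCD P))))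
    × (Πℕ[ W ] (rowLCD P) ℕ.≤ prodLCD P)
    × (Πℕ[ W ] (rowLCD P) ℕ.≤ allLCD P ^ (n ∸ 1))
lemma3p6 n P stochastic W ((v , v∈W) , escapes) =
    bounded-inverse (dominant⇒nonNegInverse (allFin n) (λ {i} _ → ∈-allFin i) (IminusP-dominant stochastic escape))
  , Π⟨⟩-mono-⊆ (rowLCD-pos P) (λ _ → refl)
  , Π⟨⟩-≤-^∸1 {S = lookup W} (proj₂ (complement-nonempty 0≤P escapes ([]=⇒lookup v∈W))) (allLCD-pos P) (λ _ → rowLCD≤allLCD P _)
  where
  0≤P : ∀ i j → 0ℚ ≤ P i j
  0≤P = proj₁ stochastic
  escape : IsEscapeRank P (lookup W) (escapeRank 0≤P escapes)
  escape = escapeRank-isEscapeRank 0≤P escapes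
  bounded-inverse : NonNegInverseOn (lookup W) (IminusP P) →
    Σ (Mat n) (λ N → IsInverseW W (IminusP P) N × (∀ i j → i ∈ W → j ∈ W → ∣ N i j ∣ ≤ ℕ→ℚ (Πℕ[ W ] (rowLCD P))))
  bounded-inverse (N , inverse , 0≤N) = N , IsInverseOn⇒IsInverseW {A = IminusP P} inverse , λ i j i∈W j∈W →
    subst (_≤ ℕ→ℚ (Πℕ[ W ] (rowLCD P))) (sym (ℚP.0≤p⇒∣p∣≡p (0≤N ([]=⇒lookup i∈W) ([]=⇒lookup j∈W))))
      (inverse-column-bounded stochastic escape (proj₁ inverse) 0≤N (rowLCD-pos P) (rowLCD-clears P) ([]=⇒lookup j∈W) ([]=⇒lookup i∈W))
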